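{- Let $\Gamma_0\subset\mathbb{R}^3$ be the Newton polyhedron at the origin of a non-constant polynomial $f(x,y,z)$ with $f(0,0,0)=0$, and suppose the compact facets of $\Gamma_0$ have been subdivided into $2$-dimensional simplices whose vertices are vertices of $\Gamma_0$. Let $\tau$ be one of these simplices. If $\tau$ is neither a $B_1$-simplex nor of type $X_2$, then $t=e^{ -2\pi i/N(\tau)}$ is a zero of the rational function $F_\tau(t)$ (i.e. $F_\tau$ has positive order of vanishing at this point).
   Context: For $I\subset\{1,2,3\}$ let $L_I=\{x\in\mathbb{R}^3: x_i=0 \text{ for all } i\notin I\}$. A face $\sigma$ of $\tau$ (a vertex, an edge, or $\tau$ itself) is a V-face if $\sigma\subset L_I$ for some $I$ with $\#I=\dim\sigma+1$; then $I_\sigma$ denotes this $I$. For a V-face $\sigma$ of positive dimension, write the equation of the affine span of $\sigma$ inside $L_{I_\sigma}$ as $\sum_{i\in I_\sigma}a_ix_i=N(\sigma)$ with positive integers $a_i$, $N(\sigma)$ and $\gcd(a_i:i\in I_\sigma)=1$; for a $0$-dimensional V-face (a vertex $l e_i$ on a coordinate axis, $l>0$) put $N(\sigma)=l$. The normalized volume $\mathrm{NV}(\sigma)$ of a lattice simplex $\sigma$ of dimension $d\ge1$ is $d!$ times its volume for the volume form on its affine span $\mathrm{Aff}(\sigma)$ for which a fundamental parallelepiped of the lattice $\mathbb{Z}^3\cap\mathrm{Aff}(\sigma)$ has volume $1$; $\mathrm{NV}=1$ for points. Put $\zeta_\sigma(t)=(1-t^{N(\sigma)})^{\mathrm{NV}(\sigma)}$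 and $F_\tau=\zeta_\tau\prod_\sigma\zeta_\sigma^{ -1}\prod_p\zeta_p$, where $\sigma$ runs over the $1$-dimensional V-faces of $\tau$ and $p$ over the $0$-dimensional V-faces of $\tau$ that are the intersection of two $1$-dimensional V-faces of $\tau$. (Here $\tau$ itself is a V-face with $I_\tau=\{1,2,3\}$, and $N(\tau)$ is the right-hand side of the equation $a_1x+a_2y+a_3z=N(\tau)$ of $\mathrm{Aff}(\tau)$ with coprime positive integers $a_i$.) $\tau$ is a $B_1$-simplex if for some coordinate $x_i$, two vertices of $\tau$ lie in the plane $x_i=0$ and the third vertex lies in the plane $x_i=1$. $\tau$ is of type $X_2$ if, up to permutation of the coordinates, its vertices are $(a,0,0)$, $(x_1,0,2)$, $(x_2,2,0)$ with $a-x_1$ and $a-x_2$ both odd. -}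

module Defs where

open import Data.Nat as ℕ using (ℕ; zero; suc)
open import Data.Nat.Divisibility using (_∣?_)
import Data.Nat.DivMod as ℕD
open import Data.Nat.GCD using (gcd)
open import Data.Integer as ℤ using (ℤ; +_; ∣_∣)
open import Data.Fin using (Fin; zero; suc)
open import Data.Bool using (Bool; true; false; if_then_else_; _∧_; _∨_)
open import Data.List using (List; [])
open import Data.List.Membership.Propositional using (_∈_)
open import Data.Product using (_×_; _,_; ∃; ∃-syntax; Σ-syntax)
open import Data.Sum using (_⊎_)
open import Relation.Nullary using (¬_; does)
open import Relation.Binary.PropositionalEquality using (_≡_; _≢_)

Pt : Set
Pt = ℕ × ℕ × ℕ

coord : Pt → Fin 3 → ℕ
coord (x , y , z) zero             = x
coord (x , y , z) (suc zero)       = y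
coord (x , y , z) (suc (suc zero)) = z

origin : Pt
origin = 0 , 0 , 0

dot : Pt → Pt → ℕ
dot (a , b , c) (x , y , z) = a ℕ.* x ℕ.+ b ℕ.* y ℕ.+ c ℕ.* z

Positive : Pt → Set
Positive w = (i : Fin 3) → 0 ℕ.< coord w i

-- Newton polyhedron Γ₀ of f, given through the support S of f
-- (the finite list of exponents of the monomials with nonzero coefficient).

NonConstantVanishing : List Pt → Set
NonConstantVanishing S = (S ≢ []) × ¬ (origin ∈ S)

-- p is a vertex (0-dimensional face) of Γ₀ : the face of Γ₀ cut out by some
-- strictly positive weight w is {p}
IsVertexΓ₀ : List Pt → Pt → Set
IsVertexΓ₀ S p = (p ∈ S) × ∃[ w ] (Positive w ×
                   ((s : Pt) → s ∈ S → s ≢ p → dot w p ℕ.< dot w s))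

ZPt : Set
ZPt = ℤ × ℤ × ℤ

toZ : Pt → ZPt
toZ (x , y , z) = + x , + y , + z

_-ᵥ_ : Pt → Pt → ZPt
p -ᵥ q = let (a , b , c) = toZ p ; (x , y , z) = toZ q
         in a ℤ.- x , b ℤ.- y , c ℤ.- z

cross : ZPt → ZPt → ZPt
cross (a , b , c) (x , y , z) =
  b ℤ.* z ℤ.- c ℤ.* y , c ℤ.* x ℤ.- a ℤ.* z , a ℤ.* y ℤ.- b ℤ.* x

dotℤ : ZPt → ZPt → ℤ
dotℤ (a , b , c) (x , y , z) = a ℤ.* x ℤ.+ b ℤ.* y ℤ.+ c ℤ.* z

zcoord : ZPt → Fin 3 → ℤ
zcoord (x , y , z) zero             = x
zcoord (x , y , z) (suc zero)       = y
zcoord (x , y , z) (suc (suc zero)) = z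

gcd3 : ZPt → ℕ
gcd3 (a , b , c) = gcd ∣ a ∣ (gcd ∣ b ∣ ∣ c ∣)

-- division in ℕ (only ever applied with nonzero divisor in the theorem)
_div_ : ℕ → ℕ → ℕ
m div zero  = 0
m div suc k = m ℕD./ suc k

normalτ : Pt → Pt → Pt → ZPt
normalτ v₁ v₂ v₃ = cross (v₂ -ᵥ v₁) (v₃ -ᵥ v₁)

NonCollinear : Pt → Pt → Pt → Set
NonCollinear v₁ v₂ v₃ = gcd3 (normalτ v₁ v₂ v₃) ≢ 0

-- τ is one of the 2-simplices of a subdivision of the compact facets of Γ₀ whose
-- vertices are vertices of Γ₀: its vertices are vertices of Γ₀, it is
-- 2-dimensional, and it lies in a compact facet (a face cut out by a strictly
-- positive weight w).
CompactFacetSimplex : List Pt → Pt → Pt → Pt → Set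
CompactFacetSimplex S v₁ v₂ v₃ =
  IsVertexΓ₀ S v₁ × IsVertexΓ₀ S v₂ × IsVertexΓ₀ S v₃ ×
  NonCollinear v₁ v₂ v₃ ×
  ∃[ w ] (Positive w × ((s : Pt) → s ∈ S →
     (dot w v₁ ℕ.≤ dot w s) × (dot w v₂ ℕ.≤ dot w s) × (dot w v₃ ℕ.≤ dot w s)))

-- N(τ): right-hand side of the primitive equation a·x = N(τ) of Aff(τ)
Nτ : Pt → Pt → Pt → ℕ
Nτ v₁ v₂ v₃ = let n = normalτ v₁ v₂ v₃ in ∣ dotℤ n (toZ v₁) ∣ div gcd3 n

-- NV(τ): normalized area = index of the lattice spanned by the edge vectors
-- in the lattice Aff(τ) ∩ ℤ³ = gcd of the 2×2 minors of the edge vectors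
NVτ : Pt → Pt → Pt → ℕ
NVτ v₁ v₂ v₃ = gcd3 (normalτ v₁ v₂ v₃)

others : Fin 3 → Fin 3 × Fin 3
others zero             = suc zero , suc (suc zero)
others (suc zero)       = zero , suc (suc zero)
others (suc (suc zero)) = zero , suc zero

isZero : ℕ → Bool
isZero zero    = true
isZero (suc _) = false

-- [p,q] ⊂ L_I with #I = 2, i.e. both endpoints in the plane x_k = 0
inCoordPlane : Fin 3 → Pt → Pt → Bool
inCoordPlane k p q = isZero (coord p k) ∧ isZero (coord q k)

-- NV of a segment: lattice length
NVedge : Pt → Pt → ℕ
NVedge p q = gcd3 (q -ᵥ p)

-- N of an edge lying in the plane x_k = 0: in coordinates (x_i, x_j) of L_I
-- the line through p, q is  d_j x_i - d_i x_j = d_j p_i - d_i p_j  (d = q - p),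
-- made primitive by dividing by gcd(d_i, d_j).
Nedge : Fin 3 → Pt → Pt → ℕ
Nedge k p q =
  let (i , j) = others k ; d = q -ᵥ p
      det = zcoord d j ℤ.* + coord p i ℤ.- zcoord d i ℤ.* + coord p j
  in ∣ det ∣ div gcd ∣ zcoord d i ∣ ∣ zcoord d j ∣

-- order of vanishing at t = e^{-2πi/M} of ζ(t) = (1 - t^N)^e :
-- 1 - t^N has simple zeros exactly at the N-th roots of unity, and
-- e^{-2πi/M} (M > 0) is an N-th root of unity iff M ∣ N.
ordζ : ℕ → ℕ → ℕ → ℤ
ordζ M N e = if does (M ∣? N) then + e else + 0

-- contribution of an edge [p,q] of τ to the order of F_τ at e^{-2πi/M}:
-- it enters as ζ_σ^{-1} when it is a 1-dimensional V-face.
edgeOrd : ℕ → Pt → Pt → ℤ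
edgeOrd M p q =
  if inCoordPlane zero p q then ordζ M (Nedge zero p q) (NVedge p q)
  else if inCoordPlane (suc zero) p q then ordζ M (Nedge (suc zero) p q) (NVedge p q)
  else if inCoordPlane (suc (suc zero)) p q then ordζ M (Nedge (suc (suc zero)) p q) (NVedge p q)
  else + 0

isEdgeV : Pt → Pt → Bool
isEdgeV p q = inCoordPlane zero p q ∨ inCoordPlane (suc zero) p q ∨
              inCoordPlane (suc (suc zero)) p q

-- p is a 0-dimensional V-face: it lies on a coordinate axis
onAxis : Pt → Bool
onAxis (x , y , z) = (isZero x ∧ isZero y) ∨ (isZero x ∧ isZero z) ∨ (isZero y ∧ isZero z)

-- N of a vertex l eᵢ is l
Nvertex : Pt → ℕ
Nvertex (x , y , z) = x ℕ.+ y ℕ.+ z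

-- contribution of the vertex p of τ whose incident edges are [p,q], [p,r]:
-- ζ_p enters when p is a 0-dimensional V-face which is the intersection of
-- two 1-dimensional V-faces of τ (NV(p) = 1).
vertexOrd : ℕ → Pt → Pt → Pt → ℤ
vertexOrd M p q r =
  if onAxis p ∧ isEdgeV p q ∧ isEdgeV p r then ordζ M (Nvertex p) 1 else + 0

-- order of vanishing of F_τ(t) at t = e^{-2πi/N(τ)}
ordFτ : Pt → Pt → Pt → ℤ
ordFτ v₁ v₂ v₃ =
  let M = Nτ v₁ v₂ v₃ in
  ordζ M M (NVτ v₁ v₂ v₃)
    ℤ.- (edgeOrd M v₁ v₂ ℤ.+ edgeOrd M v₂ v₃ ℤ.+ edgeOrd M v₁ v₃)
    ℤ.+ (vertexOrd M v₁ v₂ v₃ ℤ.+ vertexOrd M v₂ v₁ v₃ ℤ.+ vertexOrd M v₃ v₁ v₂)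

B1At : Fin 3 → Pt → Pt → Pt → Set
B1At i u v w = (coord u i ≡ 0) × (coord v i ≡ 0) × (coord w i ≡ 1)

IsB1 : Pt → Pt → Pt → Set
IsB1 v₁ v₂ v₃ = ∃[ i ] (B1At i v₂ v₃ v₁ ⊎ B1At i v₁ v₃ v₂ ⊎ B1At i v₁ v₂ v₃)

Odd : ℤ → Set
Odd n = ∃[ k ] (n ≡ + 2 ℤ.* k ℤ.+ + 1)

X2At : Fin 3 → Fin 3 → Fin 3 → Pt → Pt → Pt → Set
X2At i j k u v w =
  (i ≢ j) × (i ≢ k) × (j ≢ k) ×
  (coord u j ≡ 0) × (coord u k ≡ 0) ×
  (coord v j ≡ 0) × (coord v k ≡ 2) ×
  (coord w j ≡ 2) × (coord w k ≡ 0) ×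
  Odd (+ coord u i ℤ.- + coord v i) × Odd (+ coord u i ℤ.- + coord w i)

IsX2 : Pt → Pt → Pt → Set
IsX2 v₁ v₂ v₃ = ∃[ i ] ∃[ j ] ∃[ k ]
  (X2At i j k v₁ v₂ v₃ ⊎ X2At i j k v₁ v₃ v₂ ⊎ X2At i j k v₂ v₁ v₃ ⊎
   X2At i j k v₂ v₃ v₁ ⊎ X2At i j k v₃ v₁ v₂ ⊎ X2At i j k v₃ v₂ v₁)

-- Write M = N(τ) and g = NV(τ), so that ζ_τ contributes g to the order of F_τ at e^{-2πi/M}. An edge σ of τ
-- in a coordinate plane x_k = 0 contributes -NV(σ) exactly when M ∣ N(σ), and then the lattice geometry of the
-- cone over σ forces M = N(σ) and h · NV(σ) = g, where h is the height of the opposite vertex over the plane;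
-- h = 0 is impossible as τ is 2-dimensional and h = 1 is the B₁ case, so h ≥ 2. Hence one contributing edge
-- costs less than g, and two cost at most g, with equality only if both heights are 2, in which case their
-- common vertex l eᵢ contributes +1 unless τ is of type X₂. Three contributing edges force
-- τ = conv(l₁ e₁, l₂ e₂, l₃ e₃) with M = lcm(lᵢ, lⱼ) for all pairs, and there the inequality
-- Σ gcd(lᵢ, lⱼ) < g + #{i : M ∣ lᵢ} is elementary number theory.

module Submission where

open import Defs
open import Data.List using (List)
open import Data.List.Membership.Propositional using (_∈_)
open import Data.Integer using (_<_; +_)
open import Relation.Nullary using (¬_; yes; no; does)

open import Data.Nat as ℕ using (ℕ; zero; suc; z≤n; s≤s; _+_; _*_; _≤_; NonZero)
import Data.Nat.Properties as ℕP
open import Data.Nat.Divisibility using (_∣_; divides; _∣?_; ∣-trans; ∣-refl; ∣-reflexive; ∣-antisym; 0∣⇒≡0; ∣⇒≤; *-monoʳ-∣)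
open import Data.Nat.GCD using (gcd; gcd[m,n]∣m; gcd[m,n]∣n; gcd-greatest; gcd-comm; gcd-identityˡ; gcd-identityʳ; c*gcd[m,n]≡gcd[cm,cn]; gcd[m,n]≢0)
import Data.Nat.DivMod as ℕ/
open import Data.Nat.Coprimality using (gcd≡1⇒coprime; coprime-divisor)
open import Data.Integer as ℤ using (ℤ; -_; ∣_∣)
import Data.Integer.Properties as ℤP
import Data.Integer.Divisibility.Signed as ℤ∣
import Data.Integer.DivMod as ℤ/
open import Data.Fin using (Fin; zero; suc)
open import Data.Bool using (true; false; if_then_else_; _∧_; _∨_)
open import Data.Bool.Properties using (∨-zeroʳ)
open import Data.Product using (_×_; _,_; proj₁; proj₂; ∃-syntax)
open import Data.Sum using (_⊎_; inj₁; inj₂; [_,_]′)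
open import Function using (id)
open import Data.Empty using (⊥; ⊥-elim)
open import Relation.Binary.PropositionalEquality
import Data.Nat.Tactic.RingSolver as ℕRing
import Data.Integer.Tactic.RingSolver as ℤRing

div-*-cancel : ∀ {A G} → G ∣ A → (A div G) * G ≡ A
div-*-cancel {G = zero}  0∣A = sym (0∣⇒≡0 0∣A)
div-*-cancel {G = suc _} G∣A = ℕ/.m/n*n≡m G∣A

-- Writing N = c * M gives G = c * (h * L), and then G ∣ h * L forces c = 1.
quotient-rigidity : ∀ {h L G M N} → G ≢ 0 → G ∣ h * L → M * G ≡ h * (N * L) →
  0 ℕ.< M → M ∣ N → (h * L ≡ G) × (M ≡ N)
quotient-rigidity {h} {L} {G} {M} G≢0 (divides t hL≡tG) MG≡hNL 0<M (divides c refl) =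
  sym G≡hL , sym (trans (cong (ℕ._* M) c≡1) (ℕP.*-identityˡ M))
  where
  rearrange : ∀ h c M L → h * (c * M * L) ≡ M * (c * (h * L))
  rearrange = ℕRing.solve-∀
  G≡chL : G ≡ c * (h * L)
  G≡chL = ℕP.*-cancelˡ-≡ G (c * (h * L)) M {{ℕ.>-nonZero 0<M}}
    (trans MG≡hNL (rearrange h c M L))
  c≡1 : c ≡ 1
  c≡1 = ℕP.m*n≡1⇒m≡1 c t (ℕP.*-cancelʳ-≡ (c * t) 1 G {{ℕ.≢-nonZero G≢0}} (begin
    c * t * G   ≡⟨ ℕP.*-assoc c t G ⟩
    c * (t * G) ≡⟨ cong (c *_) (sym hL≡tG) ⟩
    c * (h * L) ≡⟨ sym G≡chL ⟩
    G           ≡⟨ sym (ℕP.*-identityˡ G) ⟩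
    1 * G       ∎))
    where open ≡-Reasoning
  G≡hL : G ≡ h * L
  G≡hL = trans G≡chL (trans (cong (ℕ._* (h * L)) c≡1) (ℕP.*-identityˡ (h * L)))

coprime-*-∣ : ∀ {a b M} → gcd a b ≡ 1 → a ∣ M → b ∣ M → a * b ∣ M
coprime-*-∣ {a} {b} gab≡1 (divides t refl) b∣ta = subst (a * b ∣_) (ℕP.*-comm a t) (*-monoʳ-∣ a b∣t)
  where
  b∣t = coprime-divisor (gcd≡1⇒coprime (trans (gcd-comm b a) gab≡1)) (subst (b ∣_) (ℕP.*-comm t a) b∣ta)

coprime₃-*-∣ : ∀ {a b c M} → gcd a b ≡ 1 → gcd a c ≡ 1 → gcd b c ≡ 1 → a ∣ M → b ∣ M → c ∣ M → a * b * c ∣ M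
coprime₃-*-∣ {a} {b} {c} gab≡1 gac≡1 gbc≡1 a∣M b∣M c∣M with coprime-*-∣ gab≡1 a∣M b∣M
... | divides t refl = subst (a * b * c ∣_) (ℕP.*-comm (a * b) t) (*-monoʳ-∣ (a * b) c∣t)
  where
  rearrange : ∀ t a b → t * (a * b) ≡ a * (b * t)
  rearrange = ℕRing.solve-∀
  c∣bt = coprime-divisor (gcd≡1⇒coprime (trans (gcd-comm c a) gac≡1)) (subst (c ∣_) (rearrange t a b) c∣M)
  c∣t  = coprime-divisor (gcd≡1⇒coprime (trans (gcd-comm c b) gbc≡1)) c∣bt

gcd-2-cases : ∀ u → ((2 ∣ u) × (gcd u 2 ≡ 2)) ⊎ ((¬ 2 ∣ u) × (gcd u 2 ≡ 1))
gcd-2-cases u with 2 ∣? u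
... | yes 2∣u = inj₁ (2∣u , ∣-antisym (gcd[m,n]∣n u 2) (gcd-greatest 2∣u ∣-refl))
... | no 2∤u  = inj₂ (2∤u , divisor-of-2 (gcd u 2) (gcd[m,n]∣n u 2) (gcd[m,n]∣m u 2))
  where
  divisor-of-2 : ∀ d → d ∣ 2 → d ∣ u → d ≡ 1
  divisor-of-2 zero             0∣2 _   = ⊥-elim (ℕP.0≢1+n (sym (0∣⇒≡0 0∣2)))
  divisor-of-2 (suc zero)       _   _   = refl
  divisor-of-2 (suc (suc zero)) _   2∣u = ⊥-elim (2∤u 2∣u)
  divisor-of-2 (suc (suc (suc _))) d∣2 _ with ∣⇒≤ d∣2
  ... | s≤s (s≤s ())

lcm-cofactors : ∀ {l l′ M} → 0 ℕ.< l → M * gcd l l′ ≡ l * l′ →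
  ∃[ a ] ∃[ a′ ] ((M ≡ a * l) × (M ≡ a′ * l′) × (gcd a a′ ≡ 1))
lcm-cofactors {l} {l′} {M} 0<l M*G≡l*l′ with gcd[m,n]∣m l l′ | gcd[m,n]∣n l l′
... | divides s l≡sG | divides s′ l′≡s′G = s′ , s , M≡s′l , M≡sl′ , coprime
  where
  G = gcd l l′
  instance
    G≢0 : NonZero G
    G≢0 = ℕ.≢-nonZero (gcd[m,n]≢0 l l′ (inj₁ λ l≡0 → ℕP.<-irrefl (sym l≡0) 0<l))
  M≡ss′G : M ≡ s * s′ * G
  M≡ss′G = ℕP.*-cancelʳ-≡ M (s * s′ * G) G (begin
    M * G          ≡⟨ M*G≡l*l′ ⟩
    l * l′         ≡⟨ cong₂ _*_ l≡sG l′≡s′G ⟩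
    s * G * (s′ * G) ≡⟨ regroup s s′ G ⟩
    s * s′ * G * G ∎)
    where
    open ≡-Reasoning
    regroup : ∀ s s′ G → s * G * (s′ * G) ≡ s * s′ * G * G
    regroup = ℕRing.solve-∀
  M≡s′l : M ≡ s′ * l
  M≡s′l = trans M≡ss′G (trans (regroup s s′ G) (cong (s′ *_) (sym l≡sG)))
    where
    regroup : ∀ s s′ G → s * s′ * G ≡ s′ * (s * G)
    regroup = ℕRing.solve-∀
  M≡sl′ : M ≡ s * l′
  M≡sl′ = trans M≡ss′G (trans (ℕP.*-assoc s s′ G) (cong (s *_) (sym l′≡s′G)))
  coprime : gcd s′ s ≡ 1
  coprime = trans (gcd-comm s′ s) (sym (ℕP.*-cancelˡ-≡ 1 (gcd s s′) G (begin
    G * 1               ≡⟨ ℕP.*-identityʳ G ⟩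
    gcd l l′            ≡⟨ cong₂ gcd (trans l≡sG (ℕP.*-comm s G)) (trans l′≡s′G (ℕP.*-comm s′ G)) ⟩
    gcd (G * s) (G * s′) ≡⟨ sym (c*gcd[m,n]≡gcd[cm,cn] G s s′) ⟩
    G * gcd s s′        ∎)))
    where open ≡-Reasoning

cofactor-unique : ∀ {a b l M} → 0 ℕ.< l → M ≡ a * l → M ≡ b * l → a ≡ b
cofactor-unique {a} {b} {l} 0<l M≡al M≡bl = ℕP.*-cancelʳ-≡ a b l {{ℕ.>-nonZero 0<l}} (trans (sym M≡al) M≡bl)

positive-factor : ∀ {m n k} → m * n ≡ k → 0 ℕ.< k → 0 ℕ.< m
positive-factor {zero} refl ()
positive-factor {suc _} _ _ = s≤s z≤n

2*cofactor≤ : ∀ {a l M} → 2 ≤ l → M ≡ a * l → 2 * a ≤ M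
2*cofactor≤ {a} {l} 2≤l M≡al = subst (2 * a ≤_) (sym M≡al) (subst (_≤ a * l) (ℕP.*-comm a 2) (ℕP.*-monoʳ-≤ a 2≤l))

m+n≤m*n : ∀ {m n} → 2 ≤ m → 2 ≤ n → m + n ≤ m * n
m+n≤m*n {suc (suc x)} {suc (suc y)} (s≤s (s≤s _)) (s≤s (s≤s _)) = subst (2 + x + (2 + y) ≤_) (sym (expand x y)) (ℕP.m≤m+n _ _)
  where
  expand : ∀ x y → (2 + x) * (2 + y) ≡ 2 + x + (2 + y) + (x + y + x * y)
  expand = ℕRing.solve-∀

coprime-sum< : ∀ {a b} → 2 ≤ a → 2 ≤ b → gcd a b ≡ 1 → suc (a + b) ≤ a * b
coprime-sum< {2} {2} (s≤s (s≤s _)) (s≤s (s≤s _)) ()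
coprime-sum< {suc (suc (suc x))} {suc (suc y)} (s≤s (s≤s _)) (s≤s (s≤s _)) _ = subst (suc (3 + x + (2 + y)) ≤_) (sym (expand x y)) (ℕP.m≤m+n _ _)
  where
  expand : ∀ x y → (3 + x) * (2 + y) ≡ suc (3 + x + (2 + y)) + (x + 2 * y + x * y)
  expand = ℕRing.solve-∀
coprime-sum< {2} {suc (suc (suc y))} (s≤s (s≤s _)) (s≤s (s≤s _)) _ = subst (suc (2 + (3 + y)) ≤_) (sym (expand y)) (ℕP.m≤m+n _ _)
  where
  expand : ∀ y → 2 * (3 + y) ≡ suc (2 + (3 + y)) + y
  expand = ℕRing.solve-∀

coprime₃-sum< : ∀ {a b c} → 2 ≤ a → 2 ≤ b → 2 ≤ c → gcd b c ≡ 1 → a + b + c ℕ.< a * b * c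
coprime₃-sum< {a} {b} {c} 2≤a 2≤b 2≤c gbc≡1 = begin-strict
  a + b + c   ≡⟨ ℕP.+-assoc a b c ⟩
  a + (b + c) <⟨ ℕP.+-monoʳ-< a (coprime-sum< 2≤b 2≤c gbc≡1) ⟩
  a + b * c   ≤⟨ m+n≤m*n 2≤a (ℕP.≤-trans 2≤b (ℕP.m≤m*n b c {{ℕ.>-nonZero (ℕP.<-≤-trans (s≤s z≤n) 2≤c)}})) ⟩
  a * (b * c) ≡⟨ sym (ℕP.*-assoc a b c) ⟩
  a * b * c   ∎
  where open ℕP.≤-Reasoning

2+a≤2*a : ∀ a → 2 ≤ a → 2 + a ≤ 2 * a
2+a≤2*a a 2≤a = subst (2 + a ≤_) (cong (ℕ._+_ a) (sym (ℕP.+-identityʳ a))) (ℕP.+-monoˡ-≤ a 2≤a)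

product-positive : ∀ a b c s → 0 ℕ.< a → 0 ℕ.< b → 0 ℕ.< c → 0 ℕ.< s → 0 ℕ.< a * b * c * s
product-positive _ _ _ _ 0<a 0<b 0<c 0<s = ℕP.*-mono-≤ (ℕP.*-mono-≤ (ℕP.*-mono-≤ 0<a 0<b) 0<c) 0<s

below-square : ∀ {M s X} → s ≤ M → 0 ℕ.< X → M * s ℕ.< M * M + X
below-square {M} s≤M 0<X = ℕP.≤-<-trans (ℕP.*-monoʳ-≤ M s≤M) (ℕP.m<m+n (M * M) 0<X)

under-square : ∀ {M s X} → s ℕ.< M → M * s ℕ.< M * M + X
under-square {M} {X = X} s<M =
  ℕP.<-≤-trans (ℕP.*-monoʳ-< M {{ℕ.>-nonZero (ℕP.≤-<-trans z≤n s<M)}} s<M) (ℕP.m≤m+n (M * M) X)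

fraction<whole : ∀ {h e g} → 2 ≤ h → h * e ≡ g → 0 ℕ.< g → e ℕ.< g
fraction<whole {e = zero}              _   _      0<g = 0<g
fraction<whole {h} {e = e@(suc _)} {g} 2≤h he≡g _ = begin-strict
  e       <⟨ ℕP.m<m+n e (s≤s z≤n) ⟩
  e + e   ≡⟨ cong (ℕ._+_ e) (sym (ℕP.+-identityʳ e)) ⟩
  2 * e   ≤⟨ ℕP.*-monoˡ-≤ e 2≤h ⟩
  h * e   ≡⟨ he≡g ⟩
  g       ∎
  where open ℕP.≤-Reasoning

-- For h ≥ 3 and h′ ≥ 2: 6 (e + f) ≤ 2 g + 3 g < 6 g.
third+half<whole : ∀ {h h′ e f g} → 3 ≤ h → 2 ≤ h′ → h * e ≡ g → h′ * f ≡ g → 0 ℕ.< g → e + f ℕ.< g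
third+half<whole {h} {h′} {e} {f} {g} 3≤h 2≤h′ he≡g h′f≡g 0<g = ℕP.*-cancelˡ-< 6 (e + f) g (begin-strict
  6 * (e + f)             ≡⟨ distribute e f ⟩
  2 * (3 * e) + 3 * (2 * f) ≤⟨ ℕP.+-mono-≤ (ℕP.*-monoʳ-≤ 2 (bound 3≤h he≡g)) (ℕP.*-monoʳ-≤ 3 (bound 2≤h′ h′f≡g)) ⟩
  2 * g + 3 * g           <⟨ ℕP.m<m+n (2 * g + 3 * g) 0<g ⟩
  2 * g + 3 * g + g       ≡⟨ collect g ⟩
  6 * g                   ∎)
  where
  open ℕP.≤-Reasoning
  bound : ∀ {c k x} → c ≤ k → k * x ≡ g → c * x ≤ g
  bound {x = x} c≤k kx≡g = subst (_ ≤_) kx≡g (ℕP.*-monoˡ-≤ x c≤k)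
  distribute : ∀ e f → 6 * (e + f) ≡ 2 * (3 * e) + 3 * (2 * f)
  distribute = ℕRing.solve-∀
  collect : ∀ g → 2 * g + 3 * g + g ≡ 6 * g
  collect = ℕRing.solve-∀

two-fractions≤whole : ∀ {h h′ e f g} → 2 ≤ h → 2 ≤ h′ → h * e ≡ g → h′ * f ≡ g → 0 ℕ.< g →
  (e + f ℕ.< g) ⊎ ((h ≡ 2) × (h′ ≡ 2) × (e + f ≡ g))
two-fractions≤whole {h@(suc (suc (suc _)))} {h′} {e} {f} {g} _ 2≤h′ he≡g h′f≡g 0<g =
  inj₁ (third+half<whole {h} {h′} {e} {f} {g} (s≤s (s≤s (s≤s z≤n))) 2≤h′ he≡g h′f≡g 0<g)
two-fractions≤whole {2} {h′@(suc (suc (suc _)))} {e} {f} {g} 2≤h _ he≡g h′f≡g 0<g =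
  inj₁ (subst (ℕ._< g) (ℕP.+-comm f e) (third+half<whole {h′} {2} {f} {e} {g} (s≤s (s≤s (s≤s z≤n))) 2≤h h′f≡g he≡g 0<g))
two-fractions≤whole {2} {2} {e} {f} _ _ 2e≡g 2f≡g _ =
  inj₂ (refl , refl , trans (cong (ℕ._+_ e) (sym e≡f)) (trans (cong (ℕ._+_ e) (sym (ℕP.+-identityʳ e))) 2e≡g))
  where
  e≡f = ℕP.*-cancelˡ-≡ e f 2 (trans 2e≡g (sym 2f≡g))
two-fractions≤whole {suc zero} (s≤s ()) _ _ _ _
two-fractions≤whole {2} {suc zero} _ (s≤s ()) _ _ _

below-sum : ∀ {x g v V} → x ℕ.< g + v → v ≤ V → x ℕ.< g + V
below-sum {g = g} x<g+v v≤V = ℕP.<-≤-trans x<g+v (ℕP.+-monoʳ-≤ g v≤V)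

∨-true : ∀ x {y} → y ≡ true → x ∨ y ≡ true
∨-true x refl = ∨-zeroʳ x

if-true : ∀ {A : Set} {b} (x y : A) → b ≡ true → (if b then x else y) ≡ x
if-true _ _ refl = refl

if-false : ∀ {A : Set} {b} (x y : A) → b ≡ false → (if b then x else y) ≡ y
if-false _ _ refl = refl

gcd3∣zcoord : ∀ n i → gcd3 n ∣ ∣ zcoord n i ∣
gcd3∣zcoord (a , b , c) zero             = gcd[m,n]∣m ∣ a ∣ _
gcd3∣zcoord (a , b , c) (suc zero)       = ∣-trans (gcd[m,n]∣n ∣ a ∣ _) (gcd[m,n]∣m ∣ b ∣ ∣ c ∣)
gcd3∣zcoord (a , b , c) (suc (suc zero)) = ∣-trans (gcd[m,n]∣n ∣ a ∣ _) (gcd[m,n]∣n ∣ b ∣ ∣ c ∣)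

gcd3∣dotℤ : ∀ n v → gcd3 n ∣ ∣ dotℤ n v ∣
gcd3∣dotℤ n (x , y , z) =
  ℤ∣.∣⇒∣ᵤ (ℤ∣.∣m∣n⇒∣m+n (ℤ∣.∣m∣n⇒∣m+n (∣zcoord* zero x) (∣zcoord* (suc zero) y)) (∣zcoord* (suc (suc zero)) z))
  where
  ∣zcoord* : ∀ i w → + gcd3 n ℤ∣.∣ zcoord n i ℤ.* w
  ∣zcoord* i w = ℤ∣.∣m⇒∣m*n w (ℤ∣.∣ᵤ⇒∣ {i = zcoord n i} (gcd3∣zcoord n i))

gcd∣det : ∀ A B P Q → gcd (∣ A ∣) (∣ B ∣) ∣ (∣ B ℤ.* P ℤ.- A ℤ.* Q ∣)
gcd∣det A B P Q = ℤ∣.∣⇒∣ᵤ (ℤ∣.∣m∣n⇒∣m-n (ℤ∣.∣m⇒∣m*n P (ℤ∣.∣ᵤ⇒∣ {+ gcd ∣ A ∣ ∣ B ∣} {B} (gcd[m,n]∣n ∣ A ∣ ∣ B ∣)))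
                                      (ℤ∣.∣m⇒∣m*n Q (ℤ∣.∣ᵤ⇒∣ {+ gcd ∣ A ∣ ∣ B ∣} {A} (gcd[m,n]∣m ∣ A ∣ ∣ B ∣))))

negZPt : ZPt → ZPt
negZPt (a , b , c) = - a , - b , - c

gcd3-negZPt : ∀ n → gcd3 (negZPt n) ≡ gcd3 n
gcd3-negZPt (a , b , c) rewrite ℤP.∣-i∣≡∣i∣ a | ℤP.∣-i∣≡∣i∣ b | ℤP.∣-i∣≡∣i∣ c = refl

dotℤ-negZPt : ∀ n v → dotℤ (negZPt n) v ≡ - dotℤ n v
dotℤ-negZPt (a , b , c) (x , y , z) = negate a b c x y z
  where
  negate : ∀ a b c x y z → - a ℤ.* x ℤ.+ - b ℤ.* y ℤ.+ - c ℤ.* z ≡ - (a ℤ.* x ℤ.+ b ℤ.* y ℤ.+ c ℤ.* z)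
  negate = ℤRing.solve-∀

zcoord-diff : ∀ p q i → zcoord (p -ᵥ q) i ≡ + coord p i ℤ.- + coord q i
zcoord-diff (a , b , c) (x , y , z) zero             = refl
zcoord-diff (a , b , c) (x , y , z) (suc zero)       = refl
zcoord-diff (a , b , c) (x , y , z) (suc (suc zero)) = refl

∣±h*z∣ : ∀ {u} h z → (u ≡ + h ℤ.* z) ⊎ (u ≡ - (+ h ℤ.* z)) → ∣ u ∣ ≡ h * ∣ z ∣
∣±h*z∣ h z (inj₁ refl) = ℤP.abs-* (+ h) z
∣±h*z∣ h z (inj₂ refl) = trans (ℤP.∣-i∣≡∣i∣ (+ h ℤ.* z)) (ℤP.abs-* (+ h) z)

odd-∣∣ : ∀ z → ¬ 2 ∣ ∣ z ∣ → Odd z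
odd-∣∣ z 2∤z with z ℤ/.%ℕ 2 | ℤ/.n%ℕd<d z 2 | ℤ/.a≡a%ℕn+[a/ℕn]*n z 2
... | zero | _ | z≡2q = ⊥-elim (2∤z (divides ∣ q ∣
  (trans (cong ∣_∣ (trans z≡2q (ℤP.+-identityˡ (q ℤ.* + 2)))) (ℤP.abs-* q (+ 2)))))
  where q = z ℤ/./ℕ 2
... | suc zero | _ | z≡1+2q = z ℤ/./ℕ 2 , trans z≡1+2q (reorder (z ℤ/./ℕ 2))
  where
  reorder : ∀ q → + 1 ℤ.+ q ℤ.* + 2 ≡ + 2 ℤ.* q ℤ.+ + 1
  reorder = ℤRing.solve-∀
... | suc (suc _) | s≤s (s≤s ()) | _

-- n = D × E is parallel to W, since W × (D × E) = D (W · E) - E (W · D) = 0.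
cross-parallel : ∀ D E W V → dotℤ D W ≡ + 0 → dotℤ E W ≡ + 0 → ∀ i →
  zcoord W i ℤ.* dotℤ (cross D E) V ≡ zcoord (cross D E) i ℤ.* dotℤ W V
cross-parallel D@(D₀ , D₁ , D₂) E@(E₀ , E₁ , E₂) (W₀ , W₁ , W₂) V@(V₀ , V₁ , V₂) DW≡0 EW≡0 i =
  vanish (zcoord (cross E V) i) (zcoord (cross V D) i) (expand i) DW≡0 EW≡0
  where
  vanish : ∀ {a b l r : ℤ} x y → l ≡ r ℤ.+ (x ℤ.* a ℤ.+ y ℤ.* b) → a ≡ + 0 → b ≡ + 0 → l ≡ r
  vanish {r = r} x y eq refl refl = trans eq (simplify r x y)
    where
    simplify : ∀ r x y → r ℤ.+ (x ℤ.* + 0 ℤ.+ y ℤ.* + 0) ≡ r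
    simplify = ℤRing.solve-∀
  n₀ = D₁ ℤ.* E₂ ℤ.- D₂ ℤ.* E₁
  n₁ = D₂ ℤ.* E₀ ℤ.- D₀ ℤ.* E₂
  n₂ = D₀ ℤ.* E₁ ℤ.- D₁ ℤ.* E₀
  expand : ∀ i → zcoord (W₀ , W₁ , W₂) i ℤ.* (n₀ ℤ.* V₀ ℤ.+ n₁ ℤ.* V₁ ℤ.+ n₂ ℤ.* V₂) ≡
    zcoord (n₀ , n₁ , n₂) i ℤ.* (W₀ ℤ.* V₀ ℤ.+ W₁ ℤ.* V₁ ℤ.+ W₂ ℤ.* V₂) ℤ.+
    (zcoord (cross (E₀ , E₁ , E₂) (V₀ , V₁ , V₂)) i ℤ.* (D₀ ℤ.* W₀ ℤ.+ D₁ ℤ.* W₁ ℤ.+ D₂ ℤ.* W₂) ℤ.+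
     zcoord (cross (V₀ , V₁ , V₂) (D₀ , D₁ , D₂)) i ℤ.* (E₀ ℤ.* W₀ ℤ.+ E₁ ℤ.* W₁ ℤ.+ E₂ ℤ.* W₂))
  expand zero             = identity₀ D₀ D₁ D₂ E₀ E₁ E₂ W₀ W₁ W₂ V₀ V₁ V₂
    where
    identity₀ : ∀ D₀ D₁ D₂ E₀ E₁ E₂ W₀ W₁ W₂ V₀ V₁ V₂ →
      W₀ ℤ.* ((D₁ ℤ.* E₂ ℤ.- D₂ ℤ.* E₁) ℤ.* V₀ ℤ.+ (D₂ ℤ.* E₀ ℤ.- D₀ ℤ.* E₂) ℤ.* V₁ ℤ.+ (D₀ ℤ.* E₁ ℤ.- D₁ ℤ.* E₀) ℤ.* V₂) ≡
      (D₁ ℤ.* E₂ ℤ.- D₂ ℤ.* E₁) ℤ.* (W₀ ℤ.* V₀ ℤ.+ W₁ ℤ.* V₁ ℤ.+ W₂ ℤ.* V₂) ℤ.+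
      ((E₁ ℤ.* V₂ ℤ.- E₂ ℤ.* V₁) ℤ.* (D₀ ℤ.* W₀ ℤ.+ D₁ ℤ.* W₁ ℤ.+ D₂ ℤ.* W₂) ℤ.+
       (V₁ ℤ.* D₂ ℤ.- V₂ ℤ.* D₁) ℤ.* (E₀ ℤ.* W₀ ℤ.+ E₁ ℤ.* W₁ ℤ.+ E₂ ℤ.* W₂))
    identity₀ = ℤRing.solve-∀
  expand (suc zero)       = identity₁ D₀ D₁ D₂ E₀ E₁ E₂ W₀ W₁ W₂ V₀ V₁ V₂
    where
    identity₁ : ∀ D₀ D₁ D₂ E₀ E₁ E₂ W₀ W₁ W₂ V₀ V₁ V₂ →
      W₁ ℤ.* ((D₁ ℤ.* E₂ ℤ.- D₂ ℤ.* E₁) ℤ.* V₀ ℤ.+ (D₂ ℤ.* E₀ ℤ.- D₀ ℤ.* E₂) ℤ.* V₁ ℤ.+ (D₀ ℤ.* E₁ ℤ.- D₁ ℤ.* E₀) ℤ.* V₂) ≡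
      (D₂ ℤ.* E₀ ℤ.- D₀ ℤ.* E₂) ℤ.* (W₀ ℤ.* V₀ ℤ.+ W₁ ℤ.* V₁ ℤ.+ W₂ ℤ.* V₂) ℤ.+
      ((E₂ ℤ.* V₀ ℤ.- E₀ ℤ.* V₂) ℤ.* (D₀ ℤ.* W₀ ℤ.+ D₁ ℤ.* W₁ ℤ.+ D₂ ℤ.* W₂) ℤ.+
       (V₂ ℤ.* D₀ ℤ.- V₀ ℤ.* D₂) ℤ.* (E₀ ℤ.* W₀ ℤ.+ E₁ ℤ.* W₁ ℤ.+ E₂ ℤ.* W₂))
    identity₁ = ℤRing.solve-∀
  expand (suc (suc zero)) = identity₂ D₀ D₁ D₂ E₀ E₁ E₂ W₀ W₁ W₂ V₀ V₁ V₂
    where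
    identity₂ : ∀ D₀ D₁ D₂ E₀ E₁ E₂ W₀ W₁ W₂ V₀ V₁ V₂ →
      W₂ ℤ.* ((D₁ ℤ.* E₂ ℤ.- D₂ ℤ.* E₁) ℤ.* V₀ ℤ.+ (D₂ ℤ.* E₀ ℤ.- D₀ ℤ.* E₂) ℤ.* V₁ ℤ.+ (D₀ ℤ.* E₁ ℤ.- D₁ ℤ.* E₀) ℤ.* V₂) ≡
      (D₀ ℤ.* E₁ ℤ.- D₁ ℤ.* E₀) ℤ.* (W₀ ℤ.* V₀ ℤ.+ W₁ ℤ.* V₁ ℤ.+ W₂ ℤ.* V₂) ℤ.+
      ((E₀ ℤ.* V₁ ℤ.- E₁ ℤ.* V₀) ℤ.* (D₀ ℤ.* W₀ ℤ.+ D₁ ℤ.* W₁ ℤ.+ D₂ ℤ.* W₂) ℤ.+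
       (V₀ ℤ.* D₁ ℤ.- V₁ ℤ.* D₀) ℤ.* (E₀ ℤ.* W₀ ℤ.+ E₁ ℤ.* W₁ ℤ.+ E₂ ℤ.* W₂))
    identity₂ = ℤRing.solve-∀

gcd3≡0 : ∀ n → (∀ i → zcoord n i ≡ + 0) → gcd3 n ≡ 0
gcd3≡0 (a , b , c) zero-coords
  rewrite zero-coords zero | zero-coords (suc zero) | zero-coords (suc (suc zero)) = refl

parallel-⊥ : ∀ n W P → (∀ i → zcoord W i ℤ.* dotℤ n P ≡ zcoord n i ℤ.* dotℤ W P) →
  dotℤ W P ≢ + 0 → dotℤ n P ≡ + 0 → ∀ i → zcoord n i ≡ + 0
parallel-⊥ n W P parallel WP≢0 nP≡0 i =
  [ id , (λ WP≡0 → ⊥-elim (WP≢0 WP≡0)) ]′ (ℤP.i*j≡0⇒i≡0∨j≡0 (zcoord n i) nᵢWP≡0)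
  where
  nᵢWP≡0 : zcoord n i ℤ.* dotℤ W P ≡ + 0
  nᵢWP≡0 = trans (sym (parallel i)) (trans (cong (zcoord W i ℤ.*_) nP≡0) (ℤP.*-zeroʳ (zcoord W i)))

dot≡dotℤ : ∀ w v → + dot w v ≡ dotℤ (toZ w) (toZ v)
dot≡dotℤ (a , b , c) (x , y , z) = begin
  + (a * x + b * y + c * z)             ≡⟨ ℤP.pos-+ (a * x + b * y) (c * z) ⟩
  + (a * x + b * y) ℤ.+ + (c * z)       ≡⟨ cong (ℤ._+ + (c * z)) (ℤP.pos-+ (a * x) (b * y)) ⟩
  + (a * x) ℤ.+ + (b * y) ℤ.+ + (c * z) ≡⟨ cong₂ ℤ._+_ (cong₂ ℤ._+_ (ℤP.pos-* a x) (ℤP.pos-* b y)) (ℤP.pos-* c z) ⟩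
  dotℤ (toZ (a , b , c)) (toZ (x , y , z)) ∎
  where open ≡-Reasoning

level-edge-⊥ : ∀ w p q → dot w p ≡ dot w q → dotℤ (q -ᵥ p) (toZ w) ≡ + 0
level-edge-⊥ w@(a , b , c) p@(x₁ , y₁ , z₁) q@(x₂ , y₂ , z₂) wp≡wq = begin
  dotℤ (q -ᵥ p) (toZ w)                         ≡⟨ difference (+ a) (+ b) (+ c) (+ x₁) (+ y₁) (+ z₁) (+ x₂) (+ y₂) (+ z₂) ⟩
  dotℤ (toZ w) (toZ q) ℤ.- dotℤ (toZ w) (toZ p) ≡⟨ cong₂ ℤ._-_ (sym (dot≡dotℤ w q)) (sym (dot≡dotℤ w p)) ⟩
  + dot w q ℤ.- + dot w p                       ≡⟨ ℤP.i≡j⇒i-j≡0 (cong +_ (sym wp≡wq)) ⟩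
  + 0                                           ∎
  where
  open ≡-Reasoning
  difference : ∀ A B C X₁ Y₁ Z₁ X₂ Y₂ Z₂ →
    (X₂ ℤ.- X₁) ℤ.* A ℤ.+ (Y₂ ℤ.- Y₁) ℤ.* B ℤ.+ (Z₂ ℤ.- Z₁) ℤ.* C ≡
    (A ℤ.* X₂ ℤ.+ B ℤ.* Y₂ ℤ.+ C ℤ.* Z₂) ℤ.- (A ℤ.* X₁ ℤ.+ B ℤ.* Y₁ ℤ.+ C ℤ.* Z₁)
  difference = ℤRing.solve-∀

dot-positive≢0 : ∀ w v → Positive w → v ≢ origin → dot w v ≢ 0
dot-positive≢0 (a , b , c) (x , y , z) pos v≢0 wv≡0 =
  v≢0 (cong₂ _,_ (factor (pos zero) ax≡0) (cong₂ _,_ (factor (pos (suc zero)) by≡0) (factor (pos (suc (suc zero))) cz≡0)))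
  where
  factor : ∀ {u t} → 0 ℕ.< u → u * t ≡ 0 → t ≡ 0
  factor {suc u} {t} _ ut≡0 = ℕP.m+n≡0⇒m≡0 t ut≡0
  ax+by≡0 = ℕP.m+n≡0⇒m≡0 (a * x + b * y) wv≡0
  cz≡0    = ℕP.m+n≡0⇒n≡0 (a * x + b * y) wv≡0
  ax≡0    = ℕP.m+n≡0⇒m≡0 (a * x) ax+by≡0
  by≡0    = ℕP.m+n≡0⇒n≡0 (a * x) ax+by≡0

-- The lattice triangle τ

offsetτ : Pt → Pt → Pt → ℕ
offsetτ p q r = ∣ dotℤ (normalτ p q r) (toZ p) ∣

Nτ*NVτ≡offsetτ : ∀ p q r → Nτ p q r * NVτ p q r ≡ offsetτ p q r
Nτ*NVτ≡offsetτ p q r = div-*-cancel (gcd3∣dotℤ (normalτ p q r) (toZ p))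

normalτ-rotate : ∀ p q r → normalτ q r p ≡ normalτ p q r
normalτ-rotate (x₁ , y₁ , z₁) (x₂ , y₂ , z₂) (x₃ , y₃ , z₃) =
  cong₂ _,_ (minor (+ y₁) (+ z₁) (+ y₂) (+ z₂) (+ y₃) (+ z₃))
    (cong₂ _,_ (minor (+ z₁) (+ x₁) (+ z₂) (+ x₂) (+ z₃) (+ x₃)) (minor (+ x₁) (+ y₁) (+ x₂) (+ y₂) (+ x₃) (+ y₃)))
  where
  minor : ∀ Y₁ Z₁ Y₂ Z₂ Y₃ Z₃ →
    (Y₃ ℤ.- Y₂) ℤ.* (Z₁ ℤ.- Z₂) ℤ.- (Z₃ ℤ.- Z₂) ℤ.* (Y₁ ℤ.- Y₂) ≡
    (Y₂ ℤ.- Y₁) ℤ.* (Z₃ ℤ.- Z₁) ℤ.- (Z₂ ℤ.- Z₁) ℤ.* (Y₃ ℤ.- Y₁)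
  minor = ℤRing.solve-∀

normalτ-swap : ∀ p q r → normalτ p r q ≡ negZPt (normalτ p q r)
normalτ-swap (x₁ , y₁ , z₁) (x₂ , y₂ , z₂) (x₃ , y₃ , z₃) =
  cong₂ _,_ (minor (+ y₁) (+ z₁) (+ y₂) (+ z₂) (+ y₃) (+ z₃))
    (cong₂ _,_ (minor (+ z₁) (+ x₁) (+ z₂) (+ x₂) (+ z₃) (+ x₃)) (minor (+ x₁) (+ y₁) (+ x₂) (+ y₂) (+ x₃) (+ y₃)))
  where
  minor : ∀ Y₁ Z₁ Y₂ Z₂ Y₃ Z₃ →
    (Y₃ ℤ.- Y₁) ℤ.* (Z₂ ℤ.- Z₁) ℤ.- (Z₃ ℤ.- Z₁) ℤ.* (Y₂ ℤ.- Y₁) ≡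
    - ((Y₂ ℤ.- Y₁) ℤ.* (Z₃ ℤ.- Z₁) ℤ.- (Z₂ ℤ.- Z₁) ℤ.* (Y₃ ℤ.- Y₁))
  minor = ℤRing.solve-∀

normalτ-⊥-edge : ∀ p q r → dotℤ (normalτ p q r) (toZ q) ≡ dotℤ (normalτ p q r) (toZ p)
normalτ-⊥-edge (x₁ , y₁ , z₁) (x₂ , y₂ , z₂) (x₃ , y₃ , z₃) =
  triple (+ x₁) (+ y₁) (+ z₁) (+ x₂) (+ y₂) (+ z₂) (+ x₃) (+ y₃) (+ z₃)
  where
  triple : ∀ X₁ Y₁ Z₁ X₂ Y₂ Z₂ X₃ Y₃ Z₃ →
    let a = X₂ ℤ.- X₁ ; b = Y₂ ℤ.- Y₁ ; c = Z₂ ℤ.- Z₁ ; x = X₃ ℤ.- X₁ ; y = Y₃ ℤ.- Y₁ ; z = Z₃ ℤ.- Z₁ in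
    (b ℤ.* z ℤ.- c ℤ.* y) ℤ.* X₂ ℤ.+ (c ℤ.* x ℤ.- a ℤ.* z) ℤ.* Y₂ ℤ.+ (a ℤ.* y ℤ.- b ℤ.* x) ℤ.* Z₂ ≡
    (b ℤ.* z ℤ.- c ℤ.* y) ℤ.* X₁ ℤ.+ (c ℤ.* x ℤ.- a ℤ.* z) ℤ.* Y₁ ℤ.+ (a ℤ.* y ℤ.- b ℤ.* x) ℤ.* Z₁
  triple = ℤRing.solve-∀

offsetτ-rotate : ∀ p q r → offsetτ q r p ≡ offsetτ p q r
offsetτ-rotate p q r =
  cong ∣_∣ (trans (cong (λ n → dotℤ n (toZ q)) (normalτ-rotate p q r)) (normalτ-⊥-edge p q r))

offsetτ-swap : ∀ p q r → offsetτ p r q ≡ offsetτ p q r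
offsetτ-swap p q r = begin
  ∣ dotℤ (normalτ p r q) (toZ p) ∣          ≡⟨ cong (λ n → ∣ dotℤ n (toZ p) ∣) (normalτ-swap p q r) ⟩
  ∣ dotℤ (negZPt (normalτ p q r)) (toZ p) ∣ ≡⟨ cong ∣_∣ (dotℤ-negZPt (normalτ p q r) (toZ p)) ⟩
  ∣ - dotℤ (normalτ p q r) (toZ p) ∣        ≡⟨ ℤP.∣-i∣≡∣i∣ (dotℤ (normalτ p q r) (toZ p)) ⟩
  offsetτ p q r                             ∎
  where open ≡-Reasoning

NVτ-rotate : ∀ p q r → NVτ q r p ≡ NVτ p q r
NVτ-rotate p q r = cong gcd3 (normalτ-rotate p q r)

NVτ-swap : ∀ p q r → NVτ p r q ≡ NVτ p q r
NVτ-swap p q r = trans (cong gcd3 (normalτ-swap p q r)) (gcd3-negZPt (normalτ p q r))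

Nτ-rotate : ∀ p q r → Nτ q r p ≡ Nτ p q r
Nτ-rotate p q r = cong₂ _div_ (offsetτ-rotate p q r) (NVτ-rotate p q r)

Nτ-swap : ∀ p q r → Nτ p r q ≡ Nτ p q r
Nτ-swap p q r = cong₂ _div_ (offsetτ-swap p q r) (NVτ-swap p q r)

-- The normal n of τ is parallel to w, so n · p = 0 would force n = 0, as w · p > 0.
Nτ-positive : ∀ w p q r → Positive w → dot w p ≡ dot w q → dot w p ≡ dot w r → p ≢ origin →
  NVτ p q r ≢ 0 → 0 ℕ.< Nτ p q r
Nτ-positive w p q r pos wp≡wq wp≡wr p≢0 NV≢0 = ℕP.n≢0⇒n>0 λ N≡0 →
  NV≢0 (gcd3≡0 (normalτ p q r) (parallel-⊥ (normalτ p q r) (toZ w) (toZ p) parallel wp≢0 (np≡0 N≡0)))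
  where
  parallel = cross-parallel (q -ᵥ p) (r -ᵥ p) (toZ w) (toZ p) (level-edge-⊥ w p q wp≡wq) (level-edge-⊥ w p r wp≡wr)
  wp≢0 : dotℤ (toZ w) (toZ p) ≢ + 0
  wp≢0 eq = dot-positive≢0 w p pos p≢0 (ℤP.+-injective (trans (dot≡dotℤ w p) eq))
  np≡0 : Nτ p q r ≡ 0 → dotℤ (normalτ p q r) (toZ p) ≡ + 0
  np≡0 N≡0 = ℤP.∣i∣≡0⇒i≡0 (trans (sym (Nτ*NVτ≡offsetτ p q r)) (cong (ℕ._* NVτ p q r) N≡0))

-- Edges in coordinate planes

edgeDet : Fin 3 → Pt → Pt → ℤ
edgeDet k p q = let (i , j) = others k ; d = q -ᵥ p in
  zcoord d j ℤ.* + coord p i ℤ.- zcoord d i ℤ.* + coord p j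

edgeGcd : Fin 3 → Pt → Pt → ℕ
edgeGcd k p q = let (i , j) = others k ; d = q -ᵥ p in gcd ∣ zcoord d i ∣ ∣ zcoord d j ∣

Nedge*edgeGcd : ∀ k p q → Nedge k p q * edgeGcd k p q ≡ ∣ edgeDet k p q ∣
Nedge*edgeGcd k p q = div-*-cancel (gcd∣det (zcoord (q -ᵥ p) (proj₁ (others k))) (zcoord (q -ᵥ p) (proj₂ (others k)))
                                            (+ coord p (proj₁ (others k))) (+ coord p (proj₂ (others k))))

NVedge-plane : ∀ k p q → coord p k ≡ 0 → coord q k ≡ 0 → NVedge p q ≡ edgeGcd k p q
NVedge-plane zero             (.0 , p₁ , p₂) (.0 , q₁ , q₂) refl refl =
  gcd-identityˡ (gcd ∣ + q₁ ℤ.- + p₁ ∣ ∣ + q₂ ℤ.- + p₂ ∣)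
NVedge-plane (suc zero)       (p₀ , .0 , p₂) (q₀ , .0 , q₂) refl refl =
  cong (gcd ∣ + q₀ ℤ.- + p₀ ∣) (gcd-identityˡ ∣ + q₂ ℤ.- + p₂ ∣)
NVedge-plane (suc (suc zero)) (p₀ , p₁ , .0) (q₀ , q₁ , .0) refl refl =
  cong (gcd ∣ + q₀ ℤ.- + p₀ ∣) (gcd-identityʳ ∣ + q₁ ℤ.- + p₁ ∣)

NVedge-sym : ∀ p q → NVedge q p ≡ NVedge p q
NVedge-sym (a , b , c) (x , y , z) =
  cong₂ gcd (ℤP.∣i-j∣≡∣j-i∣ (+ a) (+ x)) (cong₂ gcd (ℤP.∣i-j∣≡∣j-i∣ (+ b) (+ y)) (ℤP.∣i-j∣≡∣j-i∣ (+ c) (+ z)))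

Nedge-sym : ∀ k p q → Nedge k q p ≡ Nedge k p q
Nedge-sym k p q
  rewrite zcoord-diff p q (proj₁ (others k)) | zcoord-diff p q (proj₂ (others k))
        | zcoord-diff q p (proj₁ (others k)) | zcoord-diff q p (proj₂ (others k)) =
  cong₂ _div_ (trans (cong ∣_∣ (swap (+ coord p i) (+ coord p j) (+ coord q i) (+ coord q j)))
                     (ℤP.∣-i∣≡∣i∣ ((+ coord q j ℤ.- + coord p j) ℤ.* + coord p i ℤ.- (+ coord q i ℤ.- + coord p i) ℤ.* + coord p j)))
              (cong₂ gcd (ℤP.∣i-j∣≡∣j-i∣ (+ coord p i) (+ coord q i)) (ℤP.∣i-j∣≡∣j-i∣ (+ coord p j) (+ coord q j)))
  where
  i = proj₁ (others k)
  j = proj₂ (others k)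
  swap : ∀ Pᵢ Pⱼ Qᵢ Qⱼ → (Pⱼ ℤ.- Qⱼ) ℤ.* Qᵢ ℤ.- (Pᵢ ℤ.- Qᵢ) ℤ.* Qⱼ ≡ - ((Qⱼ ℤ.- Pⱼ) ℤ.* Pᵢ ℤ.- (Qᵢ ℤ.- Pᵢ) ℤ.* Pⱼ)
  swap = ℤRing.solve-∀

minor-in-plane⁺ : ∀ D E X → D ℤ.* (X ℤ.- + 0) ℤ.- (+ 0 ℤ.- + 0) ℤ.* E ≡ X ℤ.* D
minor-in-plane⁺ = ℤRing.solve-∀

minor-in-plane⁻ : ∀ D E X → (+ 0 ℤ.- + 0) ℤ.* E ℤ.- D ℤ.* (X ℤ.- + 0) ≡ - (X ℤ.* D)
minor-in-plane⁻ = ℤRing.solve-∀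

plane-edge-normal : ∀ k p q r → coord p k ≡ 0 → coord q k ≡ 0 →
  let (i , j) = others k ; d = q -ᵥ p ; n = normalτ p q r ; h = coord r k in
  (∣ zcoord n i ∣ ≡ h * ∣ zcoord d j ∣) × (∣ zcoord n j ∣ ≡ h * ∣ zcoord d i ∣) ×
  (offsetτ p q r ≡ h * ∣ edgeDet k p q ∣)
plane-edge-normal zero (.0 , p₁ , p₂) (.0 , q₁ , q₂) (r₀ , r₁ , r₂) refl refl =
  ∣±h*z∣ r₀ _ (inj₁ (minor-in-plane⁺ D₂ E₂ X)) , ∣±h*z∣ r₀ _ (inj₂ (minor-in-plane⁻ D₁ E₁ X)) ,
  ∣±h*z∣ r₀ _ (inj₁ (offset D₁ D₂ E₁ E₂ X (+ p₁) (+ p₂)))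
  where
  D₁ = + q₁ ℤ.- + p₁ ; D₂ = + q₂ ℤ.- + p₂ ; E₁ = + r₁ ℤ.- + p₁ ; E₂ = + r₂ ℤ.- + p₂ ; X = + r₀
  offset : ∀ D₁ D₂ E₁ E₂ X P₁ P₂ →
    (D₁ ℤ.* E₂ ℤ.- D₂ ℤ.* E₁) ℤ.* + 0 ℤ.+ (D₂ ℤ.* (X ℤ.- + 0) ℤ.- (+ 0 ℤ.- + 0) ℤ.* E₂) ℤ.* P₁
      ℤ.+ ((+ 0 ℤ.- + 0) ℤ.* E₁ ℤ.- D₁ ℤ.* (X ℤ.- + 0)) ℤ.* P₂ ≡ X ℤ.* (D₂ ℤ.* P₁ ℤ.- D₁ ℤ.* P₂)
  offset = ℤRing.solve-∀
plane-edge-normal (suc zero) (p₀ , .0 , p₂) (q₀ , .0 , q₂) (r₀ , r₁ , r₂) refl refl =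
  ∣±h*z∣ r₁ _ (inj₂ (minor-in-plane⁻ D₂ E₂ X)) , ∣±h*z∣ r₁ _ (inj₁ (minor-in-plane⁺ D₀ E₀ X)) ,
  ∣±h*z∣ r₁ _ (inj₂ (offset D₀ D₂ E₀ E₂ X (+ p₀) (+ p₂)))
  where
  D₀ = + q₀ ℤ.- + p₀ ; D₂ = + q₂ ℤ.- + p₂ ; E₀ = + r₀ ℤ.- + p₀ ; E₂ = + r₂ ℤ.- + p₂ ; X = + r₁
  offset : ∀ D₀ D₂ E₀ E₂ X P₀ P₂ →
    ((+ 0 ℤ.- + 0) ℤ.* E₂ ℤ.- D₂ ℤ.* (X ℤ.- + 0)) ℤ.* P₀ ℤ.+ (D₂ ℤ.* E₀ ℤ.- D₀ ℤ.* E₂) ℤ.* + 0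
      ℤ.+ (D₀ ℤ.* (X ℤ.- + 0) ℤ.- (+ 0 ℤ.- + 0) ℤ.* E₀) ℤ.* P₂ ≡ - (X ℤ.* (D₂ ℤ.* P₀ ℤ.- D₀ ℤ.* P₂))
  offset = ℤRing.solve-∀
plane-edge-normal (suc (suc zero)) (p₀ , p₁ , .0) (q₀ , q₁ , .0) (r₀ , r₁ , r₂) refl refl =
  ∣±h*z∣ r₂ _ (inj₁ (minor-in-plane⁺ D₁ E₁ X)) , ∣±h*z∣ r₂ _ (inj₂ (minor-in-plane⁻ D₀ E₀ X)) ,
  ∣±h*z∣ r₂ _ (inj₁ (offset D₀ D₁ E₀ E₁ X (+ p₀) (+ p₁)))
  where
  D₀ = + q₀ ℤ.- + p₀ ; D₁ = + q₁ ℤ.- + p₁ ; E₀ = + r₀ ℤ.- + p₀ ; E₁ = + r₁ ℤ.- + p₁ ; X = + r₂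
  offset : ∀ D₀ D₁ E₀ E₁ X P₀ P₁ →
    (D₁ ℤ.* (X ℤ.- + 0) ℤ.- (+ 0 ℤ.- + 0) ℤ.* E₁) ℤ.* P₀ ℤ.+ ((+ 0 ℤ.- + 0) ℤ.* E₀ ℤ.- D₀ ℤ.* (X ℤ.- + 0)) ℤ.* P₁
      ℤ.+ (D₀ ℤ.* E₁ ℤ.- D₁ ℤ.* E₀) ℤ.* + 0 ≡ X ℤ.* (D₁ ℤ.* P₀ ℤ.- D₀ ℤ.* P₁)
  offset = ℤRing.solve-∀

-- g divides h · NV(σ) while N(τ) · g = h · N(σ) · NV(σ), so N(τ) ∣ N(σ) forces equality in both.
plane-edge-rigidity : ∀ k p q r → coord p k ≡ 0 → coord q k ≡ 0 → NVτ p q r ≢ 0 → 0 ℕ.< Nτ p q r →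
  Nτ p q r ∣ Nedge k p q → (coord r k * NVedge p q ≡ NVτ p q r) × (Nτ p q r ≡ Nedge k p q)
plane-edge-rigidity k p q r pk≡0 qk≡0 NV≢0 0<N N∣Nedge =
  trans (cong (h *_) (NVedge-plane k p q pk≡0 qk≡0)) (proj₁ rigid) , proj₂ rigid
  where
  i = proj₁ (others k)
  j = proj₂ (others k)
  n = normalτ p q r
  d = q -ᵥ p
  h = coord r k
  L = edgeGcd k p q
  facts = plane-edge-normal k p q r pk≡0 qk≡0
  G∣hL : NVτ p q r ∣ h * L
  G∣hL = subst (NVτ p q r ∣_) (sym (c*gcd[m,n]≡gcd[cm,cn] h ∣ zcoord d i ∣ ∣ zcoord d j ∣))
    (gcd-greatest (subst (NVτ p q r ∣_) (proj₁ (proj₂ facts)) (gcd3∣zcoord n j))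
                  (subst (NVτ p q r ∣_) (proj₁ facts) (gcd3∣zcoord n i)))
  MG≡hNL : Nτ p q r * NVτ p q r ≡ h * (Nedge k p q * L)
  MG≡hNL = trans (Nτ*NVτ≡offsetτ p q r) (trans (proj₂ (proj₂ facts)) (cong (h *_) (sym (Nedge*edgeGcd k p q))))
  rigid = quotient-rigidity {h} {L} NV≢0 G∣hL MG≡hNL 0<N N∣Nedge

ordℕ : ℕ → ℕ → ℕ → ℕ
ordℕ M N e = if does (M ∣? N) then e else 0

ordζ≡ordℕ : ∀ M N e → ordζ M N e ≡ + ordℕ M N e
ordζ≡ordℕ M N e with M ∣? N
... | yes _ = refl
... | no _  = refl

ordℕ-∣ : ∀ {M N} e → M ∣ N → ordℕ M N e ≡ e
ordℕ-∣ {M} {N} e M∣N with M ∣? N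
... | yes _   = refl
... | no M∤N = ⊥-elim (M∤N M∣N)

ordℕ-∤ : ∀ {M N} e → ¬ M ∣ N → ordℕ M N e ≡ 0
ordℕ-∤ {M} {N} e M∤N with M ∣? N
... | yes M∣N = ⊥-elim (M∤N M∣N)
... | no _    = refl

ordζ-cases : ∀ M N e → (ordζ M N e ≡ + 0) ⊎ (M ∣ N × ordζ M N e ≡ + e)
ordζ-cases M N e with M ∣? N
... | yes M∣N = inj₂ (M∣N , refl)
... | no _    = inj₁ refl

vertexTerm : ℕ → Pt → Pt → Pt → ℕ
vertexTerm M p q r = if onAxis p ∧ isEdgeV p q ∧ isEdgeV p r then ordℕ M (Nvertex p) 1 else 0

vertexTotal : ℕ → Pt → Pt → Pt → ℕ
vertexTotal M v₁ v₂ v₃ = vertexTerm M v₁ v₂ v₃ + vertexTerm M v₂ v₁ v₃ + vertexTerm M v₃ v₁ v₂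

vertexOrd≡vertexTerm : ∀ M p q r → vertexOrd M p q r ≡ + vertexTerm M p q r
vertexOrd≡vertexTerm M p q r with onAxis p ∧ isEdgeV p q ∧ isEdgeV p r
... | true  = ordζ≡ordℕ M (Nvertex p) 1
... | false = refl

vertexTerm-axis : ∀ M p q r → onAxis p ≡ true → isEdgeV p q ≡ true → isEdgeV p r ≡ true →
  vertexTerm M p q r ≡ ordℕ M (Nvertex p) 1
vertexTerm-axis M p q r axis pq rq rewrite axis | pq | rq = refl

isEdgeV-plane : ∀ k p q → coord p k ≡ 0 → coord q k ≡ 0 → isEdgeV p q ≡ true
isEdgeV-plane zero             (.0 , _ , _) (.0 , _ , _) refl refl = refl
isEdgeV-plane (suc zero)       (x , .0 , _) (x′ , .0 , _) refl refl = ∨-zeroʳ (isZero x ∧ isZero x′)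
isEdgeV-plane (suc (suc zero)) (x , y , .0) (x′ , y′ , .0) refl refl =
  trans (cong ((isZero x ∧ isZero x′) ∨_) (∨-zeroʳ (isZero y ∧ isZero y′))) (∨-zeroʳ (isZero x ∧ isZero x′))

PlaneEdgeOrd : ℕ → Pt → Pt → Set
PlaneEdgeOrd M p q =
  ∃[ k ] (coord p k ≡ 0 × coord q k ≡ 0 × M ∣ Nedge k p q × edgeOrd M p q ≡ + NVedge p q)

edgeOrd-in-plane : ∀ M k p q → inCoordPlane k p q ≡ true → edgeOrd M p q ≡ ordζ M (Nedge k p q) (NVedge p q) →
  (edgeOrd M p q ≡ + 0) ⊎ PlaneEdgeOrd M p q
edgeOrd-in-plane M k p q in-k ord≡ with ordζ-cases M (Nedge k p q) (NVedge p q)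
... | inj₁ ord≡0 = inj₁ (trans ord≡ ord≡0)
... | inj₂ (M∣N , ord≡NV) = inj₂ (k , proj₁ both-zero , proj₂ both-zero , M∣N , trans ord≡ ord≡NV)
  where
  isZero-both : ∀ x y → isZero x ∧ isZero y ≡ true → (x ≡ 0) × (y ≡ 0)
  isZero-both zero    zero    _  = refl , refl
  isZero-both zero    (suc _) ()
  isZero-both (suc _) _       ()
  both-zero = isZero-both (coord p k) (coord q k) in-k

edgeOrd-cases : ∀ M p q → (edgeOrd M p q ≡ + 0) ⊎ PlaneEdgeOrd M p q
edgeOrd-cases M p q = by-plane _ _ _ refl refl refl
  where
  by-plane : ∀ b₀ b₁ b₂ → inCoordPlane zero p q ≡ b₀ → inCoordPlane (suc zero) p q ≡ b₁ →
    inCoordPlane (suc (suc zero)) p q ≡ b₂ → (edgeOrd M p q ≡ + 0) ⊎ PlaneEdgeOrd M p q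
  by-plane true  _     _     in₀ _   _   = edgeOrd-in-plane M zero p q in₀ (if-true _ _ in₀)
  by-plane false true  _     in₀ in₁ _   =
    edgeOrd-in-plane M (suc zero) p q in₁ (trans (if-false _ _ in₀) (if-true _ _ in₁))
  by-plane false false true  in₀ in₁ in₂ =
    edgeOrd-in-plane M (suc (suc zero)) p q in₂ (trans (if-false _ _ in₀) (trans (if-false _ _ in₁) (if-true _ _ in₂)))
  by-plane false false false in₀ in₁ in₂ = inj₁ (trans (if-false _ _ in₀) (trans (if-false _ _ in₁) (if-false _ _ in₂)))

-- [p, q] is an edge of τ in the plane x_plane = 0 whose factor ζ_σ vanishes at e^{-2πi/M}; r is the third vertex.
record CountedEdge (M g : ℕ) (p q r : Pt) : Set where
  constructor counted
  field
    plane     : Fin 3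
    p-in      : coord p plane ≡ 0
    q-in      : coord q plane ≡ 0
    height≥2  : 2 ≤ coord r plane
    height*NV : coord r plane * NVedge p q ≡ g
    M≡Nedge   : M ≡ Nedge plane p q

EdgeTerm : ℕ → ℕ → Pt → Pt → Pt → Set
EdgeTerm M g p q r = (edgeOrd M p q ≡ + 0) ⊎ (CountedEdge M g p q r × edgeOrd M p q ≡ + NVedge p q)

contribution : ∀ {M g p q r} → EdgeTerm M g p q r → ℕ
contribution (inj₁ _) = 0
contribution {p = p} {q} (inj₂ _) = NVedge p q

edgeTotal : ∀ {M g v₁ v₂ v₃} → EdgeTerm M g v₁ v₂ v₃ → EdgeTerm M g v₂ v₃ v₁ → EdgeTerm M g v₁ v₃ v₂ → ℕ
edgeTotal t₁₂ t₂₃ t₁₃ = contribution t₁₂ + contribution t₂₃ + contribution t₁₃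

edgeOrd≡contribution : ∀ {M g p q r} (t : EdgeTerm M g p q r) → edgeOrd M p q ≡ + contribution t
edgeOrd≡contribution (inj₁ ord≡0) = ord≡0
edgeOrd≡contribution (inj₂ (_ , ord≡NV)) = ord≡NV

-- A zero height would make g = 0; height one is the B₁ case.
edgeTerm : ∀ {M g} p q r → Nτ p q r ≡ M → NVτ p q r ≡ g → g ≢ 0 → 0 ℕ.< M → (∀ k → ¬ B1At k p q r) →
  EdgeTerm M g p q r
edgeTerm {M} {g} p q r refl refl g≢0 0<M ¬B1 with edgeOrd-cases M p q
... | inj₁ ord≡0 = inj₁ ord≡0
... | inj₂ (k , pk≡0 , qk≡0 , M∣N , ord≡NV) =
  inj₂ (counted k pk≡0 qk≡0 (height≥2 (coord r k) refl hNV≡g) hNV≡g M≡N , ord≡NV)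
  where
  rigid = plane-edge-rigidity k p q r pk≡0 qk≡0 g≢0 0<M M∣N
  hNV≡g = proj₁ rigid
  M≡N = proj₂ rigid
  height≥2 : ∀ h → h ≡ coord r k → h * NVedge p q ≡ g → 2 ≤ h
  height≥2 zero             _    0≡g = ⊥-elim (g≢0 (sym 0≡g))
  height≥2 (suc zero)       1≡rk _   = ⊥-elim (¬B1 k (pk≡0 , qk≡0 , sym 1≡rk))
  height≥2 (suc (suc _))    _    _   = s≤s (s≤s z≤n)

CountedEdge-flip : ∀ {M g p q r} → CountedEdge M g p q r → CountedEdge M g q p r
CountedEdge-flip {p = p} {q} {r} (counted k pk≡0 qk≡0 h≥2 hNV≡g M≡N) =
  counted k qk≡0 pk≡0 h≥2 (trans (cong (coord r k *_) (NVedge-sym p q)) hNV≡g) (trans M≡N (sym (Nedge-sym k p q)))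

M*NVedge≡edgeDet : ∀ {M g p q r} (e : CountedEdge M g p q r) → M * NVedge p q ≡ ∣ edgeDet (CountedEdge.plane e) p q ∣
M*NVedge≡edgeDet {p = p} {q} (counted k pk≡0 qk≡0 _ _ refl) =
  trans (cong (Nedge k p q *_) (NVedge-plane k p q pk≡0 qk≡0)) (Nedge*edgeGcd k p q)

-- Two counted edges

axisPt : Fin 3 → ℕ → Pt
axisPt zero             a = a , 0 , 0
axisPt (suc zero)       a = 0 , a , 0
axisPt (suc (suc zero)) a = 0 , 0 , a

onAxis-axisPt : ∀ i a → onAxis (axisPt i a) ≡ true
onAxis-axisPt zero             a = ∨-true (isZero a ∧ true) (∨-true (isZero a ∧ true) refl)
onAxis-axisPt (suc zero)       a = ∨-true (isZero a) refl
onAxis-axisPt (suc (suc zero)) a = refl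

Nvertex-axisPt : ∀ i a → Nvertex (axisPt i a) ≡ a
Nvertex-axisPt zero             a = trans (ℕP.+-identityʳ (a + 0)) (ℕP.+-identityʳ a)
Nvertex-axisPt (suc zero)       a = ℕP.+-identityʳ a
Nvertex-axisPt (suc (suc zero)) a = refl

M∣l-unless-both-odd : ∀ {M g l} u v → 2 * gcd u 2 ≡ g → 2 * gcd v 2 ≡ g → M * gcd u 2 ≡ 2 * l →
  (¬ 2 ∣ u → ¬ 2 ∣ v → ⊥) → M ∣ l
M∣l-unless-both-odd {M} {g} {l} u v 2gu≡g 2gv≡g Mgu≡2l odd-odd with gcd-2-cases u | gcd-2-cases v
... | inj₁ (_ , gu≡2) | _ = ∣-reflexive (ℕP.*-cancelʳ-≡ M l 2 (begin
  M * 2       ≡⟨ cong (M *_) (sym gu≡2) ⟩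
  M * gcd u 2 ≡⟨ Mgu≡2l ⟩
  2 * l       ≡⟨ ℕP.*-comm 2 l ⟩
  l * 2       ∎))
  where open ≡-Reasoning
... | inj₂ (2∤u , _) | inj₂ (2∤v , _) = ⊥-elim (odd-odd 2∤u 2∤v)
... | inj₂ (_ , gu≡1) | inj₁ (_ , gv≡2) with trans (cong (2 *_) (sym gu≡1)) (trans 2gu≡g (trans (sym 2gv≡g) (cong (2 *_) gv≡2)))
...   | ()

height-two-det⁺ : ∀ X L → (+ 2 ℤ.- + 0) ℤ.* L ℤ.- X ℤ.* + 0 ≡ + 2 ℤ.* L
height-two-det⁺ = ℤRing.solve-∀

height-two-det⁻ : ∀ X L → X ℤ.* + 0 ℤ.- (+ 2 ℤ.- + 0) ℤ.* L ≡ - (+ 2 ℤ.* L)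
height-two-det⁻ = ℤRing.solve-∀

shared-vertex-configuration : ∀ k m p q r → coord p k ≡ 0 → coord q k ≡ 0 → coord p m ≡ 0 → coord r m ≡ 0 →
  coord r k ≡ 2 → coord q m ≡ 2 →
  ∃[ i ] ((i ≢ k) × (i ≢ m) × (k ≢ m) × (onAxis p ≡ true) × (Nvertex p ≡ coord p i) ×
          (NVedge p q ≡ gcd ∣ + coord q i ℤ.- + coord p i ∣ 2) × (NVedge p r ≡ gcd ∣ + coord r i ℤ.- + coord p i ∣ 2) ×
          (∣ edgeDet k p q ∣ ≡ 2 * coord p i))
shared-vertex-configuration (suc (suc zero)) (suc zero) (l , .0 , .0) (x , .2 , .0) (y , .0 , .2) refl refl refl refl refl refl =
  zero , (λ ()) , (λ ()) , (λ ()) , onAxis-axisPt zero l , Nvertex-axisPt zero l , refl , refl ,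
  ∣±h*z∣ 2 (+ l) (inj₁ (height-two-det⁺ (+ x ℤ.- + l) (+ l)))
shared-vertex-configuration (suc zero) (suc (suc zero)) (l , .0 , .0) (x , .0 , .2) (y , .2 , .0) refl refl refl refl refl refl =
  zero , (λ ()) , (λ ()) , (λ ()) , onAxis-axisPt zero l , Nvertex-axisPt zero l , refl , refl ,
  ∣±h*z∣ 2 (+ l) (inj₁ (height-two-det⁺ (+ x ℤ.- + l) (+ l)))
shared-vertex-configuration (suc (suc zero)) zero (.0 , l , .0) (.2 , x , .0) (.0 , y , .2) refl refl refl refl refl refl =
  suc zero , (λ ()) , (λ ()) , (λ ()) , onAxis-axisPt (suc zero) l , Nvertex-axisPt (suc zero) l ,
  trans (cong (gcd 2) (gcd-identityʳ u)) (gcd-comm 2 u) , gcd-identityˡ (gcd v 2) ,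
  ∣±h*z∣ 2 (+ l) (inj₂ (height-two-det⁻ (+ x ℤ.- + l) (+ l)))
  where u = ∣ + x ℤ.- + l ∣ ; v = ∣ + y ℤ.- + l ∣
shared-vertex-configuration zero (suc (suc zero)) (.0 , l , .0) (.0 , x , .2) (.2 , y , .0) refl refl refl refl refl refl =
  suc zero , (λ ()) , (λ ()) , (λ ()) , onAxis-axisPt (suc zero) l , Nvertex-axisPt (suc zero) l ,
  gcd-identityˡ (gcd u 2) , trans (cong (gcd 2) (gcd-identityʳ v)) (gcd-comm 2 v) ,
  ∣±h*z∣ 2 (+ l) (inj₁ (height-two-det⁺ (+ x ℤ.- + l) (+ l)))
  where u = ∣ + x ℤ.- + l ∣ ; v = ∣ + y ℤ.- + l ∣
shared-vertex-configuration (suc zero) zero (.0 , .0 , l) (.2 , .0 , x) (.0 , .2 , y) refl refl refl refl refl refl =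
  suc (suc zero) , (λ ()) , (λ ()) , (λ ()) , onAxis-axisPt (suc (suc zero)) l , Nvertex-axisPt (suc (suc zero)) l ,
  trans (cong (gcd 2) (gcd-identityˡ u)) (gcd-comm 2 u) , trans (gcd-identityˡ (gcd 2 v)) (gcd-comm 2 v) ,
  ∣±h*z∣ 2 (+ l) (inj₂ (height-two-det⁻ (+ x ℤ.- + l) (+ l)))
  where u = ∣ + x ℤ.- + l ∣ ; v = ∣ + y ℤ.- + l ∣
shared-vertex-configuration zero (suc zero) (.0 , .0 , l) (.0 , .2 , x) (.2 , .0 , y) refl refl refl refl refl refl =
  suc (suc zero) , (λ ()) , (λ ()) , (λ ()) , onAxis-axisPt (suc (suc zero)) l , Nvertex-axisPt (suc (suc zero)) l ,
  trans (gcd-identityˡ (gcd 2 u)) (gcd-comm 2 u) , trans (cong (gcd 2) (gcd-identityˡ v)) (gcd-comm 2 v) ,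
  ∣±h*z∣ 2 (+ l) (inj₂ (height-two-det⁻ (+ x ℤ.- + l) (+ l)))
  where u = ∣ + x ℤ.- + l ∣ ; v = ∣ + y ℤ.- + l ∣
shared-vertex-configuration zero             zero             _ _ (.0 , _ , _) _ _ _ refl () _
shared-vertex-configuration (suc zero)       (suc zero)       _ _ (_ , .0 , _) _ _ _ refl () _
shared-vertex-configuration (suc (suc zero)) (suc (suc zero)) _ _ (_ , _ , .0) _ _ _ refl () _

-- With both heights 2, NV of the two edges is gcd(u, 2) resp. gcd(v, 2) for the offsets u, v along the
-- axis of p, and N(τ) = 2 l / gcd(u, 2); unless u and v are both odd (type X₂), N(τ) divides l.
shared-vertex-term : ∀ {M g p q r} (e : CountedEdge M g p q r) (e′ : CountedEdge M g p r q) →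
  coord r (CountedEdge.plane e) ≡ 2 → coord q (CountedEdge.plane e′) ≡ 2 → (∀ i j k → ¬ X2At i j k p q r) →
  vertexTerm M p q r ≡ 1
shared-vertex-term {M} {g} {p} {q} {r} e@(counted k pk≡0 qk≡0 _ rk*NV≡g _) (counted m pm≡0 rm≡0 _ qm*NV≡g _) rk≡2 qm≡2 ¬X2
  with shared-vertex-configuration k m p q r pk≡0 qk≡0 pm≡0 rm≡0 rk≡2 qm≡2
... | i , i≢k , i≢m , k≢m , axis , Nvertex≡ , NVpq≡ , NVpr≡ , det≡ = begin
  vertexTerm M p q r      ≡⟨ vertexTerm-axis M p q r axis (isEdgeV-plane k p q pk≡0 qk≡0) (isEdgeV-plane m p r pm≡0 rm≡0) ⟩
  ordℕ M (Nvertex p) 1    ≡⟨ cong (λ l → ordℕ M l 1) Nvertex≡ ⟩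
  ordℕ M (coord p i) 1    ≡⟨ ordℕ-∣ {M} {coord p i} 1 (M∣l-unless-both-odd u v 2gu≡g 2gv≡g Mgu≡2l odd-odd) ⟩
  1                       ∎
  where
  open ≡-Reasoning
  u = ∣ + coord q i ℤ.- + coord p i ∣
  v = ∣ + coord r i ℤ.- + coord p i ∣
  2gu≡g : 2 * gcd u 2 ≡ g
  2gu≡g = subst₂ (λ h NV → h * NV ≡ g) rk≡2 NVpq≡ rk*NV≡g
  2gv≡g : 2 * gcd v 2 ≡ g
  2gv≡g = subst₂ (λ h NV → h * NV ≡ g) qm≡2 NVpr≡ qm*NV≡g
  Mgu≡2l : M * gcd u 2 ≡ 2 * coord p i
  Mgu≡2l = trans (cong (M *_) (sym NVpq≡)) (trans (M*NVedge≡edgeDet e) det≡)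
  odd : ∀ s → ¬ 2 ∣ ∣ + coord s i ℤ.- + coord p i ∣ → Odd (+ coord p i ℤ.- + coord s i)
  odd s 2∤ = odd-∣∣ _ (subst (λ n → ¬ 2 ∣ n) (ℤP.∣i-j∣≡∣j-i∣ (+ coord s i) (+ coord p i)) 2∤)
  odd-odd : ¬ 2 ∣ u → ¬ 2 ∣ v → ⊥
  odd-odd 2∤u 2∤v = ¬X2 i k m (i≢k , i≢m , k≢m , pk≡0 , pm≡0 , qk≡0 , qm≡2 , rk≡2 , rm≡0 , odd q 2∤u , odd r 2∤v)

two-edges-at-vertex : ∀ {M g p q r} → 0 ℕ.< g → (∀ i j k → ¬ X2At i j k p q r) →
  CountedEdge M g p q r → CountedEdge M g p r q → NVedge p q + NVedge p r ℕ.< g + vertexTerm M p q r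
two-edges-at-vertex {M} {g} {p} {q} {r} 0<g ¬X2 e@(counted _ _ _ h≥2 hNV≡g _) e′@(counted _ _ _ h′≥2 h′NV≡g _)
  with two-fractions≤whole h≥2 h′≥2 hNV≡g h′NV≡g 0<g
... | inj₁ sum<g = ℕP.<-≤-trans sum<g (ℕP.m≤m+n g _)
... | inj₂ (h≡2 , h′≡2 , sum≡g) = begin-strict
  NVedge p q + NVedge p r ≡⟨ sum≡g ⟩
  g                       <⟨ ℕP.n<1+n g ⟩
  suc g                   ≡⟨ ℕP.+-comm 1 g ⟩
  g + 1                   ≡⟨ cong (ℕ._+_ g) (sym (shared-vertex-term e e′ h≡2 h′≡2 ¬X2)) ⟩
  g + vertexTerm M p q r  ∎
  where open ℕP.≤-Reasoning

-- Three counted edges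

Cofactor : ℕ → ℕ → Set
Cofactor a P = ((a ≡ 1) × (P ≡ 1)) ⊎ ((2 ≤ a) × (P ≡ 0))

cofactor-ordℕ : ∀ {a l M} → 0 ℕ.< M → 0 ℕ.< l → M ≡ a * l → Cofactor a (ordℕ M l 1)
cofactor-ordℕ {zero}        0<M _   refl = ⊥-elim (ℕP.<-irrefl refl 0<M)
cofactor-ordℕ {suc zero}    _   _   M≡l  = inj₁ (refl , ordℕ-∣ 1 (∣-reflexive (trans M≡l (ℕP.*-identityˡ _))))
cofactor-ordℕ {suc (suc a)} {l} {M} _ 0<l M≡a*l = inj₂ (s≤s (s≤s z≤n) , ordℕ-∤ 1 M∤l)
  where
  l<M : l ℕ.< M
  l<M = subst (l ℕ.<_) (sym M≡a*l) (ℕP.m<m+n l (ℕP.<-≤-trans 0<l (ℕP.m≤m+n l (a * l))))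
  M∤l : ¬ M ∣ l
  M∤l M∣l = ℕP.<⇒≱ l<M (∣⇒≤ {{ℕ.>-nonZero 0<l}} M∣l)

-- Pairwise coprime aᵢ ≥ 2 have a₁ + a₂ + a₃ < a₁ a₂ a₃ ≤ M; every aᵢ = 1 instead contributes Pᵢ = 1.
cofactor-inequality : ∀ {M a₁ a₂ a₃ P₁ P₂ P₃} → 2 * a₁ ≤ M → 2 * a₂ ≤ M → 2 * a₃ ≤ M →
  gcd a₁ a₂ ≡ 1 → gcd a₁ a₃ ≡ 1 → gcd a₂ a₃ ≡ 1 → a₁ * a₂ * a₃ ≤ M →
  Cofactor a₁ P₁ → Cofactor a₂ P₂ → Cofactor a₃ P₃ →
  M * (a₁ + a₂ + a₃) ℕ.< M * M + a₁ * a₂ * a₃ * (P₁ + P₂ + P₃)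
cofactor-inequality {suc (suc t)} _ _ _ _ _ _ _ (inj₁ (refl , refl)) (inj₁ (refl , refl)) (inj₁ (refl , refl)) =
  subst ((2 + t) * 3 ℕ.<_) (expand t) (ℕP.m<m+n ((2 + t) * 3) (s≤s z≤n))
  where
  expand : ∀ t → (2 + t) * 3 + suc (t * t + t) ≡ (2 + t) * (2 + t) + 3
  expand = ℕRing.solve-∀
cofactor-inequality {suc zero} (s≤s ()) _ _ _ _ _ _ (inj₁ (refl , refl)) (inj₁ (refl , refl)) (inj₁ (refl , refl))
cofactor-inequality {M} {a₃ = a} _ _ 2a≤M _ _ _ _ (inj₁ (refl , refl)) (inj₁ (refl , refl)) (inj₂ (2≤a , refl)) =
  below-square (ℕP.≤-trans (2+a≤2*a a 2≤a) 2a≤M) (product-positive 1 1 a 2 (s≤s z≤n) (s≤s z≤n) (ℕP.<⇒≤ 2≤a) (s≤s z≤n))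
cofactor-inequality {M} {a₂ = a} _ 2a≤M _ _ _ _ _ (inj₁ (refl , refl)) (inj₂ (2≤a , refl)) (inj₁ (refl , refl)) =
  below-square (subst (_≤ M) (cong suc (ℕP.+-comm 1 a)) (ℕP.≤-trans (2+a≤2*a a 2≤a) 2a≤M))
    (product-positive 1 a 1 2 (s≤s z≤n) (ℕP.<⇒≤ 2≤a) (s≤s z≤n) (s≤s z≤n))
cofactor-inequality {M} {a₁ = a} 2a≤M _ _ _ _ _ _ (inj₂ (2≤a , refl)) (inj₁ (refl , refl)) (inj₁ (refl , refl)) =
  below-square (subst (_≤ M) (sym (trans (ℕP.+-assoc a 1 1) (ℕP.+-comm a 2))) (ℕP.≤-trans (2+a≤2*a a 2≤a) 2a≤M))
    (product-positive a 1 1 2 (ℕP.<⇒≤ 2≤a) (s≤s z≤n) (s≤s z≤n) (s≤s z≤n))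
cofactor-inequality {M} {a₂ = a} {a₃ = b} _ _ _ _ _ gab≡1 Q≤M (inj₁ (refl , refl)) (inj₂ (2≤a , refl)) (inj₂ (2≤b , refl)) =
  below-square (ℕP.≤-trans (coprime-sum< 2≤a 2≤b gab≡1) (subst (_≤ M) (cong (_* b) (ℕP.*-identityˡ a)) Q≤M))
    (product-positive 1 a b 1 (s≤s z≤n) (ℕP.<⇒≤ 2≤a) (ℕP.<⇒≤ 2≤b) (s≤s z≤n))
cofactor-inequality {M} {a₁ = a} {a₃ = b} _ _ _ _ gab≡1 _ Q≤M (inj₂ (2≤a , refl)) (inj₁ (refl , refl)) (inj₂ (2≤b , refl)) =
  below-square (subst (_≤ M) (sym (cong (_+ b) (ℕP.+-comm a 1)))
                 (ℕP.≤-trans (coprime-sum< 2≤a 2≤b gab≡1) (subst (_≤ M) (cong (_* b) (ℕP.*-identityʳ a)) Q≤M)))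
    (product-positive a 1 b 1 (ℕP.<⇒≤ 2≤a) (s≤s z≤n) (ℕP.<⇒≤ 2≤b) (s≤s z≤n))
cofactor-inequality {M} {a₁ = a} {a₂ = b} _ _ _ gab≡1 _ _ Q≤M (inj₂ (2≤a , refl)) (inj₂ (2≤b , refl)) (inj₁ (refl , refl)) =
  below-square (subst (_≤ M) (ℕP.+-comm 1 (a + b))
                 (ℕP.≤-trans (coprime-sum< 2≤a 2≤b gab≡1) (subst (_≤ M) (ℕP.*-identityʳ (a * b)) Q≤M)))
    (product-positive a b 1 1 (ℕP.<⇒≤ 2≤a) (ℕP.<⇒≤ 2≤b) (s≤s z≤n) (s≤s z≤n))
cofactor-inequality _ _ _ _ _ gbc≡1 Q≤M (inj₂ (2≤a , refl)) (inj₂ (2≤b , refl)) (inj₂ (2≤c , refl)) =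
  under-square (ℕP.<-≤-trans (coprime₃-sum< 2≤a 2≤b 2≤c gbc≡1) Q≤M)

-- Multiplying by a₁ a₂ a₃ M turns l_i l_j into M² a_k and l₁ l₂ l₃ into M³.
cofactor-rescaling : ∀ {M g X S a₁ a₂ a₃ l₁ l₂ l₃} → 0 ℕ.< M →
  M ≡ a₁ * l₁ → M ≡ a₂ * l₂ → M ≡ a₃ * l₃ → M * X ≡ l₁ * l₂ + l₂ * l₃ + l₁ * l₃ → M * g ≡ l₁ * l₂ * l₃ →
  M * (a₁ + a₂ + a₃) ℕ.< M * M + a₁ * a₂ * a₃ * S → X ℕ.< g + S
cofactor-rescaling {M} {g} {X} {S} {a₁} {a₂} {a₃} {l₁} {l₂} {l₃} 0<M M≡₁ M≡₂ M≡₃ MX≡ Mg≡ cofactor-bound =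
  ℕP.*-cancelˡ-< M X (g + S) (ℕP.*-cancelˡ-< Q (M * X) (M * (g + S))
    (subst₂ ℕ._<_ (sym QMX≡) (sym QMY≡) (ℕP.*-monoʳ-< M {{ℕ.>-nonZero 0<M}} cofactor-bound)))
  where
  open ≡-Reasoning
  Q = a₁ * a₂ * a₃
  QMX≡ : Q * (M * X) ≡ M * (M * (a₁ + a₂ + a₃))
  QMX≡ = begin
    Q * (M * X)                                          ≡⟨ cong (Q *_) MX≡ ⟩
    Q * (l₁ * l₂ + l₂ * l₃ + l₁ * l₃)                    ≡⟨ pair-up a₁ a₂ a₃ l₁ l₂ l₃ ⟩
    (a₁ * l₁) * (a₂ * l₂) * a₃ + (a₂ * l₂) * (a₃ * l₃) * a₁ + (a₁ * l₁) * (a₃ * l₃) * a₂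
      ≡⟨ sym (cong₂ _+_ (cong₂ _+_ (cong₂ (λ x y → x * y * a₃) M≡₁ M≡₂) (cong₂ (λ x y → x * y * a₁) M≡₂ M≡₃))
                                  (cong₂ (λ x y → x * y * a₂) M≡₁ M≡₃)) ⟩
    M * M * a₃ + M * M * a₁ + M * M * a₂                 ≡⟨ collect M a₁ a₂ a₃ ⟩
    M * (M * (a₁ + a₂ + a₃))                             ∎
    where
    pair-up : ∀ a₁ a₂ a₃ l₁ l₂ l₃ → a₁ * a₂ * a₃ * (l₁ * l₂ + l₂ * l₃ + l₁ * l₃) ≡
      (a₁ * l₁) * (a₂ * l₂) * a₃ + (a₂ * l₂) * (a₃ * l₃) * a₁ + (a₁ * l₁) * (a₃ * l₃) * a₂
    pair-up = ℕRing.solve-∀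
    collect : ∀ M a₁ a₂ a₃ → M * M * a₃ + M * M * a₁ + M * M * a₂ ≡ M * (M * (a₁ + a₂ + a₃))
    collect = ℕRing.solve-∀
  QMY≡ : Q * (M * (g + S)) ≡ M * (M * M + Q * S)
  QMY≡ = begin
    Q * (M * (g + S))                      ≡⟨ cong (Q *_) (ℕP.*-distribˡ-+ M g S) ⟩
    Q * (M * g + M * S)                    ≡⟨ cong (λ x → Q * (x + M * S)) Mg≡ ⟩
    Q * (l₁ * l₂ * l₃ + M * S)             ≡⟨ triple-up a₁ a₂ a₃ l₁ l₂ l₃ M S ⟩
    (a₁ * l₁) * (a₂ * l₂) * (a₃ * l₃) + Q * M * S
      ≡⟨ cong (_+ Q * M * S) (sym (cong₂ _*_ (cong₂ _*_ M≡₁ M≡₂) M≡₃)) ⟩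
    M * M * M + Q * M * S                  ≡⟨ collect M Q S ⟩
    M * (M * M + Q * S)                    ∎
    where
    triple-up : ∀ a₁ a₂ a₃ l₁ l₂ l₃ M S → a₁ * a₂ * a₃ * (l₁ * l₂ * l₃ + M * S) ≡
      (a₁ * l₁) * (a₂ * l₂) * (a₃ * l₃) + a₁ * a₂ * a₃ * M * S
    triple-up = ℕRing.solve-∀
    collect : ∀ M Q S → M * M * M + Q * M * S ≡ M * (M * M + Q * S)
    collect = ℕRing.solve-∀

-- N(τ) is lcm(lᵢ, lⱼ) for every pair, so the cofactors aᵢ = N(τ) / lᵢ are pairwise coprime.
axis-triangle-inequality : ∀ {M g l₁ l₂ l₃} → 2 ≤ l₁ → 2 ≤ l₂ → 2 ≤ l₃ → l₃ * gcd l₁ l₂ ≡ g →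
  M * gcd l₁ l₂ ≡ l₁ * l₂ → M * gcd l₂ l₃ ≡ l₂ * l₃ → M * gcd l₁ l₃ ≡ l₁ * l₃ →
  gcd l₁ l₂ + gcd l₂ l₃ + gcd l₁ l₃ ℕ.< g + (ordℕ M l₁ 1 + ordℕ M l₂ 1 + ordℕ M l₃ 1)
axis-triangle-inequality {M} {g} {l₁} {l₂} {l₃} 2≤l₁ 2≤l₂ 2≤l₃ l₃G≡g M₁₂ M₂₃ M₁₃ =
  from-cofactors (lcm-cofactors 0<l₁ M₁₂) (lcm-cofactors 0<l₂ M₂₃) (lcm-cofactors 0<l₁ M₁₃)
  where
  0<l₁ = ℕP.<-≤-trans (s≤s z≤n) 2≤l₁
  0<l₂ = ℕP.<-≤-trans (s≤s z≤n) 2≤l₂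
  0<l₃ = ℕP.<-≤-trans (s≤s z≤n) 2≤l₃
  0<M : 0 ℕ.< M
  0<M = positive-factor M₁₂ (ℕP.*-mono-≤ 0<l₁ 0<l₂)
  MX≡ : M * (gcd l₁ l₂ + gcd l₂ l₃ + gcd l₁ l₃) ≡ l₁ * l₂ + l₂ * l₃ + l₁ * l₃
  MX≡ = trans (distribute M (gcd l₁ l₂) (gcd l₂ l₃) (gcd l₁ l₃)) (cong₂ _+_ (cong₂ _+_ M₁₂ M₂₃) M₁₃)
    where
    distribute : ∀ M x y z → M * (x + y + z) ≡ M * x + M * y + M * z
    distribute = ℕRing.solve-∀
  Mg≡ : M * g ≡ l₁ * l₂ * l₃
  Mg≡ = trans (cong (M *_) (sym l₃G≡g)) (trans (swap M l₃ (gcd l₁ l₂)) (trans (cong (l₃ *_) M₁₂) (ℕP.*-comm l₃ (l₁ * l₂))))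
    where
    swap : ∀ M l G → M * (l * G) ≡ l * (M * G)
    swap = ℕRing.solve-∀
  a∣M : ∀ {a l} → M ≡ a * l → a ∣ M
  a∣M {a} {l} M≡al = divides l (trans M≡al (ℕP.*-comm a l))
  from-cofactors : ∃[ a₁ ] ∃[ a₂ ] ((M ≡ a₁ * l₁) × (M ≡ a₂ * l₂) × (gcd a₁ a₂ ≡ 1)) →
    ∃[ a₂ ] ∃[ a₃ ] ((M ≡ a₂ * l₂) × (M ≡ a₃ * l₃) × (gcd a₂ a₃ ≡ 1)) →
    ∃[ a₁ ] ∃[ a₃ ] ((M ≡ a₁ * l₁) × (M ≡ a₃ * l₃) × (gcd a₁ a₃ ≡ 1)) →
    gcd l₁ l₂ + gcd l₂ l₃ + gcd l₁ l₃ ℕ.< g + (ordℕ M l₁ 1 + ordℕ M l₂ 1 + ordℕ M l₃ 1)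
  from-cofactors (a₁ , a₂ , M≡₁ , M≡₂ , g₁₂≡1) (b₂ , a₃ , M≡₂′ , M≡₃ , g₂₃≡1) (c₁ , c₃ , M≡₁′ , M≡₃′ , g₁₃≡1) =
    cofactor-rescaling {M} {g} {a₁ = a₁} {a₂} {a₃} 0<M M≡₁ M≡₂ M≡₃ MX≡ Mg≡
      (cofactor-inequality {M} {a₁} {a₂} {a₃} (2*cofactor≤ {a₁} 2≤l₁ M≡₁) (2*cofactor≤ {a₂} 2≤l₂ M≡₂) (2*cofactor≤ {a₃} 2≤l₃ M≡₃)
        g₁₂≡1 gcd₁₃≡1 gcd₂₃≡1
        (∣⇒≤ {{ℕ.>-nonZero 0<M}} (coprime₃-*-∣ {a₁} {a₂} {a₃} g₁₂≡1 gcd₁₃≡1 gcd₂₃≡1 (a∣M {a₁} M≡₁) (a∣M {a₂} M≡₂) (a∣M {a₃} M≡₃)))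
        (cofactor-ordℕ 0<M 0<l₁ M≡₁) (cofactor-ordℕ 0<M 0<l₂ M≡₂) (cofactor-ordℕ 0<M 0<l₃ M≡₃))
    where
    gcd₂₃≡1 : gcd a₂ a₃ ≡ 1
    gcd₂₃≡1 = subst (λ b → gcd b a₃ ≡ 1) (cofactor-unique {b₂} {a₂} 0<l₂ M≡₂′ M≡₂) g₂₃≡1
    gcd₁₃≡1 : gcd a₁ a₃ ≡ 1
    gcd₁₃≡1 = subst₂ (λ a c → gcd a c ≡ 1) (cofactor-unique {c₁} {a₁} 0<l₁ M≡₁′ M≡₁) (cofactor-unique {c₃} {a₃} 0<l₃ M≡₃′ M≡₃) g₁₃≡1

-- Junk on the diagonal i ≡ j.
third : Fin 3 → Fin 3 → Fin 3
third zero             (suc zero)       = suc (suc zero)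
third zero             (suc (suc zero)) = suc zero
third (suc zero)       zero             = suc (suc zero)
third (suc zero)       (suc (suc zero)) = zero
third (suc (suc zero)) zero             = suc zero
third (suc (suc zero)) (suc zero)       = zero
third i                _                = i

∣0-a∣ : ∀ a → ∣ + 0 ℤ.- + a ∣ ≡ a
∣0-a∣ a = trans (cong ∣_∣ (ℤP.+-identityˡ (- + a))) (ℤP.∣-i∣≡∣i∣ (+ a))

∣a-0∣ : ∀ a → ∣ + a ℤ.- + 0 ∣ ≡ a
∣a-0∣ = ℕP.+-identityʳ

axis-det⁺ : ∀ A B → (B ℤ.- + 0) ℤ.* A ℤ.- (+ 0 ℤ.- A) ℤ.* + 0 ≡ A ℤ.* B
axis-det⁺ = ℤRing.solve-∀

axis-det⁻ : ∀ A B → (+ 0 ℤ.- A) ℤ.* + 0 ℤ.- (B ℤ.- + 0) ℤ.* A ≡ - (A ℤ.* B)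
axis-det⁻ = ℤRing.solve-∀

axis-edge : ∀ i j a b → i ≢ j → let p = axisPt i a ; q = axisPt j b ; k = third i j in
  (NVedge p q ≡ gcd a b) × (edgeGcd k p q ≡ gcd a b) × (∣ edgeDet k p q ∣ ≡ a * b) × (isEdgeV p q ≡ true)
axis-edge zero (suc zero) a b _ =
  cong₂ gcd (∣0-a∣ a) (trans (cong (λ x → gcd x 0) (∣a-0∣ b)) (gcd-identityʳ b)) ,
  cong₂ gcd (∣0-a∣ a) (∣a-0∣ b) , ∣±h*z∣ a (+ b) (inj₁ (axis-det⁺ (+ a) (+ b))) , ∨-true (isZero a ∧ true) (∨-true (isZero b) refl)
axis-edge (suc zero) zero a b _ =
  trans (cong₂ gcd (∣a-0∣ b) (trans (cong (λ x → gcd x 0) (∣0-a∣ a)) (gcd-identityʳ a))) (gcd-comm b a) ,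
  trans (cong₂ gcd (∣a-0∣ b) (∣0-a∣ a)) (gcd-comm b a) , ∣±h*z∣ a (+ b) (inj₂ (axis-det⁻ (+ a) (+ b))) ,
  ∨-true (isZero b) (∨-true (isZero a ∧ true) refl)
axis-edge zero (suc (suc zero)) a b _ =
  cong₂ gcd (∣0-a∣ a) (trans (gcd-identityˡ _) (∣a-0∣ b)) ,
  cong₂ gcd (∣0-a∣ a) (∣a-0∣ b) , ∣±h*z∣ a (+ b) (inj₁ (axis-det⁺ (+ a) (+ b))) , ∨-true (isZero a ∧ true) refl
axis-edge (suc (suc zero)) zero a b _ =
  trans (cong₂ gcd (∣a-0∣ b) (trans (gcd-identityˡ _) (∣0-a∣ a))) (gcd-comm b a) ,
  trans (cong₂ gcd (∣a-0∣ b) (∣0-a∣ a)) (gcd-comm b a) , ∣±h*z∣ a (+ b) (inj₂ (axis-det⁻ (+ a) (+ b))) ,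
  ∨-true (isZero b) refl
axis-edge (suc zero) (suc (suc zero)) a b _ =
  trans (gcd-identityˡ _) (cong₂ gcd (∣0-a∣ a) (∣a-0∣ b)) ,
  cong₂ gcd (∣0-a∣ a) (∣a-0∣ b) , ∣±h*z∣ a (+ b) (inj₁ (axis-det⁺ (+ a) (+ b))) , refl
axis-edge (suc (suc zero)) (suc zero) a b _ =
  trans (gcd-identityˡ _) (trans (cong₂ gcd (∣a-0∣ b) (∣0-a∣ a)) (gcd-comm b a)) ,
  trans (cong₂ gcd (∣a-0∣ b) (∣0-a∣ a)) (gcd-comm b a) , ∣±h*z∣ a (+ b) (inj₂ (axis-det⁻ (+ a) (+ b))) , refl
axis-edge zero             zero             _ _ i≢i = ⊥-elim (i≢i refl)
axis-edge (suc zero)       (suc zero)       _ _ i≢i = ⊥-elim (i≢i refl)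
axis-edge (suc (suc zero)) (suc (suc zero)) _ _ i≢i = ⊥-elim (i≢i refl)

axis-edge-lcm : ∀ {M} i j a b → i ≢ j → M ≡ Nedge (third i j) (axisPt i a) (axisPt j b) → M * gcd a b ≡ a * b
axis-edge-lcm i j a b i≢j refl with axis-edge i j a b i≢j
... | _ , edgeGcd≡ , det≡ , _ =
  trans (cong (Nedge (third i j) (axisPt i a) (axisPt j b) *_) (sym edgeGcd≡))
        (trans (Nedge*edgeGcd (third i j) (axisPt i a) (axisPt j b)) det≡)

vertexTerm-axes : ∀ M i j m a b c → i ≢ j → i ≢ m →
  vertexTerm M (axisPt i a) (axisPt j b) (axisPt m c) ≡ ordℕ M a 1
vertexTerm-axes M i j m a b c i≢j i≢m =
  trans (vertexTerm-axis M (axisPt i a) (axisPt j b) (axisPt m c) (onAxis-axisPt i a) (proj₂ (proj₂ (proj₂ (axis-edge i j a b i≢j))))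
                                                     (proj₂ (proj₂ (proj₂ (axis-edge i m a c i≢m)))))
        (cong (λ l → ordℕ M l 1) (Nvertex-axisPt i a))

axis-triangle-bound : ∀ {M g} i j m a b c → i ≢ j → j ≢ m → i ≢ m → 2 ≤ a → 2 ≤ b → 2 ≤ c →
  c * NVedge (axisPt i a) (axisPt j b) ≡ g → M ≡ Nedge (third i j) (axisPt i a) (axisPt j b) →
  M ≡ Nedge (third j m) (axisPt j b) (axisPt m c) → M ≡ Nedge (third i m) (axisPt i a) (axisPt m c) →
  let p = axisPt i a ; q = axisPt j b ; r = axisPt m c in
  NVedge p q + NVedge q r + NVedge p r ℕ.< g + vertexTotal M p q r
axis-triangle-bound {M} {g} i j m a b c i≢j j≢m i≢m 2≤a 2≤b 2≤c cNV≡g M≡₁₂ M≡₂₃ M≡₁₃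
  rewrite proj₁ (axis-edge i j a b i≢j) | proj₁ (axis-edge j m b c j≢m) | proj₁ (axis-edge i m a c i≢m)
        | vertexTerm-axes M i j m a b c i≢j i≢m | vertexTerm-axes M j i m b a c (≢-sym i≢j) j≢m
        | vertexTerm-axes M m i j c a b (≢-sym i≢m) (≢-sym j≢m) =
  axis-triangle-inequality {M} {g} {a} {b} {c} 2≤a 2≤b 2≤c cNV≡g
    (axis-edge-lcm i j a b i≢j M≡₁₂) (axis-edge-lcm j m b c j≢m M≡₂₃) (axis-edge-lcm i m a c i≢m M≡₁₃)

three-edges-bound : ∀ {M g v₁ v₂ v₃} → CountedEdge M g v₁ v₂ v₃ → CountedEdge M g v₂ v₃ v₁ → CountedEdge M g v₁ v₃ v₂ →
  NVedge v₁ v₂ + NVedge v₂ v₃ + NVedge v₁ v₃ ℕ.< g + vertexTotal M v₁ v₂ v₃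
three-edges-bound {v₁ = .0 , l₁ , .0} {(.0 , .0 , l₂)} {(l₃ , .0 , .0)}
  (counted zero refl refl h₃ hNV M₁₂) (counted (suc zero) refl refl h₁ _ M₂₃) (counted (suc (suc zero)) refl refl h₂ _ M₁₃) =
  axis-triangle-bound (suc zero) (suc (suc zero)) zero l₁ l₂ l₃ (λ ()) (λ ()) (λ ()) h₁ h₂ h₃ hNV M₁₂ M₂₃ M₁₃
three-edges-bound {v₁ = .0 , .0 , l₁} {(.0 , l₂ , .0)} {(l₃ , .0 , .0)}
  (counted zero refl refl h₃ hNV M₁₂) (counted (suc (suc zero)) refl refl h₁ _ M₂₃) (counted (suc zero) refl refl h₂ _ M₁₃) =
  axis-triangle-bound (suc (suc zero)) (suc zero) zero l₁ l₂ l₃ (λ ()) (λ ()) (λ ()) h₁ h₂ h₃ hNV M₁₂ M₂₃ M₁₃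
three-edges-bound {v₁ = l₁ , .0 , .0} {(.0 , .0 , l₂)} {(.0 , l₃ , .0)}
  (counted (suc zero) refl refl h₃ hNV M₁₂) (counted zero refl refl h₁ _ M₂₃) (counted (suc (suc zero)) refl refl h₂ _ M₁₃) =
  axis-triangle-bound zero (suc (suc zero)) (suc zero) l₁ l₂ l₃ (λ ()) (λ ()) (λ ()) h₁ h₂ h₃ hNV M₁₂ M₂₃ M₁₃
three-edges-bound {v₁ = .0 , .0 , l₁} {(l₂ , .0 , .0)} {(.0 , l₃ , .0)}
  (counted (suc zero) refl refl h₃ hNV M₁₂) (counted (suc (suc zero)) refl refl h₁ _ M₂₃) (counted zero refl refl h₂ _ M₁₃) =
  axis-triangle-bound (suc (suc zero)) zero (suc zero) l₁ l₂ l₃ (λ ()) (λ ()) (λ ()) h₁ h₂ h₃ hNV M₁₂ M₂₃ M₁₃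
three-edges-bound {v₁ = l₁ , .0 , .0} {(.0 , l₂ , .0)} {(.0 , .0 , l₃)}
  (counted (suc (suc zero)) refl refl h₃ hNV M₁₂) (counted zero refl refl h₁ _ M₂₃) (counted (suc zero) refl refl h₂ _ M₁₃) =
  axis-triangle-bound zero (suc zero) (suc (suc zero)) l₁ l₂ l₃ (λ ()) (λ ()) (λ ()) h₁ h₂ h₃ hNV M₁₂ M₂₃ M₁₃
three-edges-bound {v₁ = .0 , l₁ , .0} {(l₂ , .0 , .0)} {(.0 , .0 , l₃)}
  (counted (suc (suc zero)) refl refl h₃ hNV M₁₂) (counted (suc zero) refl refl h₁ _ M₂₃) (counted zero refl refl h₂ _ M₁₃) =
  axis-triangle-bound (suc zero) zero (suc (suc zero)) l₁ l₂ l₃ (λ ()) (λ ()) (λ ()) h₁ h₂ h₃ hNV M₁₂ M₂₃ M₁₃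
three-edges-bound (counted zero refl _ _ _ _) (counted zero _ _ () _ _) _
three-edges-bound (counted (suc zero) refl _ _ _ _) (counted (suc zero) _ _ () _ _) _
three-edges-bound (counted (suc (suc zero)) refl _ _ _ _) (counted (suc (suc zero)) _ _ () _ _) _
three-edges-bound (counted zero _ refl _ _ _) _ (counted zero _ _ () _ _)
three-edges-bound (counted (suc zero) _ refl _ _ _) _ (counted (suc zero) _ _ () _ _)
three-edges-bound (counted (suc (suc zero)) _ refl _ _ _) _ (counted (suc (suc zero)) _ _ () _ _)
three-edges-bound _ (counted zero _ _ () _ _) (counted zero refl _ _ _ _)
three-edges-bound _ (counted (suc zero) _ _ () _ _) (counted (suc zero) refl _ _ _ _)
three-edges-bound _ (counted (suc (suc zero)) _ _ () _ _) (counted (suc (suc zero)) refl _ _ _ _)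

edge-vertex-bound : ∀ {M g v₁ v₂ v₃} → 0 ℕ.< g → ¬ IsX2 v₁ v₂ v₃ →
  (t₁₂ : EdgeTerm M g v₁ v₂ v₃) (t₂₃ : EdgeTerm M g v₂ v₃ v₁) (t₁₃ : EdgeTerm M g v₁ v₃ v₂) →
  edgeTotal t₁₂ t₂₃ t₁₃ ℕ.< g + vertexTotal M v₁ v₂ v₃
edge-vertex-bound {M} {g} {v₁} {v₂} {v₃} 0<g ¬X2 = bound
  where
  V₁ = vertexTerm M v₁ v₂ v₃
  V₂ = vertexTerm M v₂ v₁ v₃
  V₃ = vertexTerm M v₃ v₁ v₂
  total = g + (V₁ + V₂ + V₃)
  V₁≤ : V₁ ≤ V₁ + V₂ + V₃
  V₁≤ = ℕP.≤-trans (ℕP.m≤m+n V₁ V₂) (ℕP.m≤m+n (V₁ + V₂) V₃)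
  V₂≤ : V₂ ≤ V₁ + V₂ + V₃
  V₂≤ = ℕP.≤-trans (ℕP.m≤n+m V₂ V₁) (ℕP.m≤m+n (V₁ + V₂) V₃)
  V₃≤ : V₃ ≤ V₁ + V₂ + V₃
  V₃≤ = ℕP.m≤n+m V₃ (V₁ + V₂)
  single : ∀ {p q r} → CountedEdge M g p q r → NVedge p q ℕ.< total
  single (counted _ _ _ h≥2 hNV≡g _) = ℕP.<-≤-trans (fraction<whole h≥2 hNV≡g 0<g) (ℕP.m≤m+n g (V₁ + V₂ + V₃))
  bound : (t₁₂ : EdgeTerm M g v₁ v₂ v₃) (t₂₃ : EdgeTerm M g v₂ v₃ v₁) (t₁₃ : EdgeTerm M g v₁ v₃ v₂) →
    contribution t₁₂ + contribution t₂₃ + contribution t₁₃ ℕ.< total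
  bound (inj₁ _) (inj₁ _) (inj₁ _) = ℕP.<-≤-trans 0<g (ℕP.m≤m+n g (V₁ + V₂ + V₃))
  bound (inj₂ (e₁₂ , _)) (inj₁ _) (inj₁ _) =
    subst (ℕ._< total) (sym (trans (ℕP.+-identityʳ (NVedge v₁ v₂ + 0)) (ℕP.+-identityʳ (NVedge v₁ v₂)))) (single e₁₂)
  bound (inj₁ _) (inj₂ (e₂₃ , _)) (inj₁ _) = subst (ℕ._< total) (sym (ℕP.+-identityʳ (NVedge v₂ v₃))) (single e₂₃)
  bound (inj₁ _) (inj₁ _) (inj₂ (e₁₃ , _)) = single e₁₃
  bound (inj₂ (e₁₂ , _)) (inj₂ (e₂₃ , _)) (inj₁ _) =
    subst (ℕ._< total) (trans (cong (_+ NVedge v₂ v₃) (NVedge-sym v₁ v₂)) (sym (ℕP.+-identityʳ (NVedge v₁ v₂ + NVedge v₂ v₃))))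
      (below-sum (two-edges-at-vertex 0<g (λ i j k x → ¬X2 (i , j , k , inj₂ (inj₂ (inj₁ x))))
                                      (CountedEdge-flip e₁₂) e₂₃) V₂≤)
  bound (inj₂ (e₁₂ , _)) (inj₁ _) (inj₂ (e₁₃ , _)) =
    subst (ℕ._< total) (cong (_+ NVedge v₁ v₃) (sym (ℕP.+-identityʳ (NVedge v₁ v₂))))
      (below-sum (two-edges-at-vertex 0<g (λ i j k x → ¬X2 (i , j , k , inj₁ x)) e₁₂ e₁₃) V₁≤)
  bound (inj₁ _) (inj₂ (e₂₃ , _)) (inj₂ (e₁₃ , _)) =
    subst (ℕ._< total) (trans (ℕP.+-comm (NVedge v₃ v₁) (NVedge v₃ v₂)) (cong₂ _+_ (NVedge-sym v₂ v₃) (NVedge-sym v₁ v₃)))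
      (below-sum (two-edges-at-vertex 0<g (λ i j k x → ¬X2 (i , j , k , inj₂ (inj₂ (inj₂ (inj₂ (inj₁ x))))))
                                      (CountedEdge-flip e₁₃) (CountedEdge-flip e₂₃)) V₃≤)
  bound (inj₂ (e₁₂ , _)) (inj₂ (e₂₃ , _)) (inj₂ (e₁₃ , _)) = three-edges-bound e₁₂ e₂₃ e₁₃

pos-sum₃ : ∀ a b c → + (a + b + c) ≡ + a ℤ.+ + b ℤ.+ + c
pos-sum₃ a b c = trans (ℤP.pos-+ (a + b) c) (cong (ℤ._+ + c) (ℤP.pos-+ a b))

ordFτ-decomposition : ∀ v₁ v₂ v₃ → let M = Nτ v₁ v₂ v₃ ; g = NVτ v₁ v₂ v₃ in
  (t₁₂ : EdgeTerm M g v₁ v₂ v₃) (t₂₃ : EdgeTerm M g v₂ v₃ v₁) (t₁₃ : EdgeTerm M g v₁ v₃ v₂) →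
  ordFτ v₁ v₂ v₃ ≡ + g ℤ.- + edgeTotal t₁₂ t₂₃ t₁₃ ℤ.+ + vertexTotal M v₁ v₂ v₃
ordFτ-decomposition v₁ v₂ v₃ t₁₂ t₂₃ t₁₃ =
  cong₂ ℤ._+_ (cong₂ ℤ._-_ ordζτ≡g edges) vertices
  where
  M = Nτ v₁ v₂ v₃
  g = NVτ v₁ v₂ v₃
  ordζτ≡g : ordζ M M g ≡ + g
  ordζτ≡g = trans (ordζ≡ordℕ M M g) (cong +_ (ordℕ-∣ {M} {M} g ∣-refl))
  edges : edgeOrd M v₁ v₂ ℤ.+ edgeOrd M v₂ v₃ ℤ.+ edgeOrd M v₁ v₃ ≡ + edgeTotal t₁₂ t₂₃ t₁₃
  edges = trans (cong₂ ℤ._+_ (cong₂ ℤ._+_ (edgeOrd≡contribution t₁₂) (edgeOrd≡contribution t₂₃)) (edgeOrd≡contribution t₁₃))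
                (sym (pos-sum₃ (contribution t₁₂) (contribution t₂₃) (contribution t₁₃)))
  vertices : vertexOrd M v₁ v₂ v₃ ℤ.+ vertexOrd M v₂ v₁ v₃ ℤ.+ vertexOrd M v₃ v₁ v₂ ≡ + vertexTotal M v₁ v₂ v₃
  vertices = trans (cong₂ ℤ._+_ (cong₂ ℤ._+_ (vertexOrd≡vertexTerm M v₁ v₂ v₃) (vertexOrd≡vertexTerm M v₂ v₁ v₃))
                               (vertexOrd≡vertexTerm M v₃ v₁ v₂))
                   (sym (pos-sum₃ (vertexTerm M v₁ v₂ v₃) (vertexTerm M v₂ v₁ v₃) (vertexTerm M v₃ v₁ v₂)))

difference-positive : ∀ g E P → E ℕ.< g + P → + 0 < + g ℤ.- + E ℤ.+ + P
difference-positive g E P E<g+P = subst (+ 0 <_) (sym as-natural) (ℤ.+<+ (ℕP.m<n⇒0<n∸m E<g+P))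
  where
  open ≡-Reasoning
  regroup : ∀ G E P → G ℤ.- E ℤ.+ P ≡ (G ℤ.+ P) ℤ.- E
  regroup = ℤRing.solve-∀
  as-natural : + g ℤ.- + E ℤ.+ + P ≡ + ((g + P) ℕ.∸ E)
  as-natural = begin
    + g ℤ.- + E ℤ.+ + P   ≡⟨ regroup (+ g) (+ E) (+ P) ⟩
    (+ g ℤ.+ + P) ℤ.- + E ≡⟨ cong (ℤ._- + E) (sym (ℤP.pos-+ g P)) ⟩
    + (g + P) ℤ.- + E     ≡⟨ ℤP.[+m]-[+n]≡m⊖n (g + P) E ⟩
    (g + P) ℤ.⊖ E         ≡⟨ ℤP.⊖-≥ (ℕP.<⇒≤ E<g+P) ⟩
    + ((g + P) ℕ.∸ E)     ∎

mainTheorem2 : (S : List Pt) → NonConstantVanishing S →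
    (v₁ v₂ v₃ : Pt) → CompactFacetSimplex S v₁ v₂ v₃ →
    ¬ IsB1 v₁ v₂ v₃ → ¬ IsX2 v₁ v₂ v₃ →
    + 0 < ordFτ v₁ v₂ v₃
mainTheorem2 S (_ , origin∉S) v₁ v₂ v₃ ((v₁∈S , _) , (v₂∈S , _) , (v₃∈S , _) , NV≢0 , w , w-positive , w-minimal) ¬B1 ¬X2 =
  subst (+ 0 <_) (sym (ordFτ-decomposition v₁ v₂ v₃ t₁₂ t₂₃ t₁₃))
    (difference-positive (NVτ v₁ v₂ v₃) (edgeTotal t₁₂ t₂₃ t₁₃) (vertexTotal (Nτ v₁ v₂ v₃) v₁ v₂ v₃)
      (edge-vertex-bound (ℕP.n≢0⇒n>0 NV≢0) ¬X2 t₁₂ t₂₃ t₁₃))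
  where
  level₂ : dot w v₁ ≡ dot w v₂
  level₂ = ℕP.≤-antisym (proj₁ (w-minimal v₂ v₂∈S)) (proj₁ (proj₂ (w-minimal v₁ v₁∈S)))
  level₃ : dot w v₁ ≡ dot w v₃
  level₃ = ℕP.≤-antisym (proj₁ (w-minimal v₃ v₃∈S)) (proj₂ (proj₂ (w-minimal v₁ v₁∈S)))
  0<M : 0 ℕ.< Nτ v₁ v₂ v₃
  0<M = Nτ-positive w v₁ v₂ v₃ w-positive level₂ level₃ (λ v₁≡0 → origin∉S (subst (_∈ S) v₁≡0 v₁∈S)) NV≢0
  t₁₂ = edgeTerm v₁ v₂ v₃ refl refl NV≢0 0<M (λ k b → ¬B1 (k , inj₂ (inj₂ b)))
  t₂₃ = edgeTerm v₂ v₃ v₁ (Nτ-rotate v₁ v₂ v₃) (NVτ-rotate v₁ v₂ v₃) NV≢0 0<M (λ k b → ¬B1 (k , inj₁ b))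
  t₁₃ = edgeTerm v₁ v₃ v₂ (Nτ-swap v₁ v₂ v₃) (NVτ-swap v₁ v₂ v₃) NV≢0 0<M (λ k b → ¬B1 (k , inj₂ (inj₁ b)))
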